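{- Let $G$ be a cubic subgrid on $n$ vertices and let $C$ be the cycle graph on $n$ vertices. There exists a bijection $\pi: V(C)\to V(G)$ such that $x^T L_{\pi(C)} x\le x^T L_G x$ for all $x\in\mathbb{R}^{V(G)}$ if and only if $G$ contains a Hamiltonian cycle.
   Context: Let $G^\infty$ be the infinite graph whose vertices are the points of the plane with integer coordinates, two points being adjacent iff their Euclidean distance is $1$. A cubic subgrid is a finite subgraph of $G^\infty$ in which every vertex has degree at most $3$. For an unweighted graph $G$, $L_G$ denotes its Laplacian, so that $x^T L_G x=\sum_{(i,j)\in E(G)}(x_i-x_j)^2$. For a bijection $\pi:V(C)\to V(G)$, $\pi(C)$ is the graph on $V(G)$ with edge set $\{(\pi(a),\pi(b)) : (a,b)\in E(C)\}$.
   Formalization: The vectors x in the inequality $x^T L_{\pi(C)} x\le x^T L_G x$ have rational entries rather than real ones. -}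

module Defs where

open import Data.Nat as ℕ using (ℕ; zero; suc; _≤_; _≡ᵇ_; _<ᵇ_)
open import Data.Fin using (Fin; toℕ)
open import Data.Bool using (Bool; true; false; _∧_; _∨_; if_then_else_)
open import Data.Integer as ℤ using (ℤ)
open import Data.Product using (_×_; _,_; proj₁; proj₂)
open import Data.List using (List; foldr; map; allFin)
open import Data.Rational as ℚ using (ℚ)
open import Function.Bundles using (_↔_; Inverse)
open import Function.Definitions using (Injective)
open import Relation.Binary.PropositionalEquality using (_≡_)

-- A simple graph on vertex set Fin n, given by a Bool-valued adjacency
-- (only symmetric, irreflexive ones are used).
Adj : ℕ → Set
Adj n = Fin n → Fin n → Bool

sumℕ : ∀ {n} → (Fin n → ℕ) → ℕ
sumℕ {n} f = foldr ℕ._+_ 0 (map f (allFin n))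

sumℚ : ∀ {n} → (Fin n → ℚ) → ℚ
sumℚ {n} f = foldr ℚ._+_ ℚ.0ℚ (map f (allFin n))

degree : ∀ {n} → Adj n → Fin n → ℕ
degree A i = sumℕ (λ j → if A i j then 1 else 0)

gridAdjacent : ℤ × ℤ → ℤ × ℤ → Set
gridAdjacent (x₁ , y₁) (x₂ , y₂) =
  (x₁ ℤ.- x₂) ℤ.* (x₁ ℤ.- x₂) ℤ.+ (y₁ ℤ.- y₂) ℤ.* (y₁ ℤ.- y₂) ≡ ℤ.+ 1

-- A cubic subgrid on n vertices: a finite subgraph of G^∞ (n distinct lattice
-- points, edge set a subset of the unit-distance pairs) with max degree ≤ 3.
record CubicSubgrid (n : ℕ) : Set where
  field
    pos       : Fin n → ℤ × ℤ
    pos-inj   : Injective _≡_ _≡_ pos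
    adj       : Adj n
    adj-sym   : ∀ i j → adj i j ≡ adj j i
    adj-irr   : ∀ i → adj i i ≡ false
    adj-grid  : ∀ i j → adj i j ≡ true → gridAdjacent (pos i) (pos j)
    deg≤3     : ∀ i → degree adj i ≤ 3

-- The cycle graph C_n on Fin n: a ~ b iff b = a+1 (mod n) or a = b+1 (mod n).
succModAdj : (n : ℕ) → ℕ → ℕ → Bool
succModAdj n a b = (b ≡ᵇ suc a) ∨ ((suc a ≡ᵇ n) ∧ (b ≡ᵇ 0))

cycleAdj : (n : ℕ) → Adj n
cycleAdj n a b = succModAdj n (toℕ a) (toℕ b) ∨ succModAdj n (toℕ b) (toℕ a)

-- π(C): the graph on V(G) with edges (π a, π b) for (a,b) ∈ E(C).
imageAdj : ∀ {n} → (Fin n ↔ Fin n) → Adj n → Adj n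
imageAdj π C u v = C (Inverse.from π u) (Inverse.from π v)

-- Laplacian quadratic form x^T L_G x = Σ_{ {i,j} ∈ E(G) } (x_i - x_j)^2,
-- each unordered edge counted once (via i < j).
quadForm : ∀ {n} → Adj n → (Fin n → ℚ) → ℚ
quadForm A x = sumℚ (λ i → sumℚ (λ j →
  if (toℕ i <ᵇ toℕ j) ∧ A i j
  then (x i ℚ.- x j) ℚ.* (x i ℚ.- x j)
  else ℚ.0ℚ))

HasHamiltonianCycle : ∀ {n} → Adj n → Set
HasHamiltonianCycle {n} A =
  Σ' (Fin n ↔ Fin n) λ σ → ∀ a b → cycleAdj n a b ≡ true →
    A (Inverse.to σ a) (Inverse.to σ b) ≡ true
  where open import Data.Product renaming (Σ to Σ')

-- If G has a Hamiltonian cycle σ, then π = σ embeds C in G and the energy of π(C) is a sub-sum of that of G.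
-- Conversely let H = π(C) with L_H ≼ L_G, and call an edge of H missing from G bad. For a bad edge uv the
-- vector e_u − e_v has the same energy 6 in H and in G (H is 2-regular, G has degree ≤ 3), so it lies in the
-- kernel of the positive semidefinite L_G − L_H; testing 2(e_u − e_v) + e_w shows that u and v see every
-- other vertex w in the same way. With the degree bound this makes every bad edge uv a diagonal of a 4-cycle
-- u w v z of G whose other diagonal wz is bad too, and no side of which is in H. The 2-opt exchange of uv, wz
-- for two opposite sides keeps a Hamiltonian cycle of the complete graph, removes two bad edges and
-- preserves this structure, so iterating it ends in a Hamiltonian cycle of G.

module Submission where

open import Algebra.Bundles using (CommutativeRing)
open import Data.Bool using (Bool; true; false; if_then_else_; _∧_)
import Data.Bool.Properties as Bool
open import Data.Empty using (⊥; ⊥-elim)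
open import Data.Fin as Fin using (Fin; zero; suc; toℕ)
import Data.Fin.Properties as Fin
open import Data.List as List using (List; []; _∷_; _++_; [_]; _∷ʳ_; _∷ʳ′_; foldr; map; allFin; tabulate; length; lookup; reverse; filter)
import Data.List.Properties as List
open import Data.List.Membership.Propositional using (_∈_; _∉_)
open import Data.List.Membership.Propositional.Properties using (∈-lookup; ∈-allFin; ∈-filter⁺; ∈-filter⁻; ∈-++⁺ˡ; ∈-++⁺ʳ; ∈-tabulate⁺)
open import Data.List.Relation.Binary.Permutation.Propositional using (_↭_; ↭-refl; ↭-sym; ↭-trans; ↭-reflexive; ↭⇒↭ₛ)
import Data.List.Relation.Binary.Permutation.Propositional.Properties as Perm
import Data.List.Relation.Binary.Permutation.Setoid.Properties as PermSetoid
open import Data.List.Relation.Binary.Subset.Propositional using (_⊆_)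
open import Data.List.Relation.Unary.All as All using (All; []; _∷_)
import Data.List.Relation.Unary.All.Properties as AllP
open import Data.List.Relation.Unary.AllPairs using ([]; _∷_)
import Data.List.Relation.Unary.Any as Any
open import Data.List.Relation.Unary.Any using (here; there)
open import Data.List.Relation.Unary.Any.Properties using (lookup-index)
open import Data.List.Relation.Unary.Unique.Propositional using (Unique)
import Data.List.Relation.Unary.Unique.Propositional.Properties as Unique
open import Data.Nat as ℕ using (ℕ; zero; suc; _≤_; _<_; s≤s; z≤n)
import Data.Nat.Properties as ℕ
import Data.Nat.Induction as ℕ
open import Data.Product as Product using (Σ; ∃; ∃₂; _×_; _,_; proj₁; proj₂)
open import Data.Rational as ℚ using (ℚ; 0ℚ; 1ℚ; ½)
import Data.Rational.Properties as ℚ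
open import Data.Rational.Solver using (module +-*-Solver)
open import Data.Nat.Tactic.RingSolver using (solve-∀)
open import Data.Sum as Sum using (_⊎_; inj₁; inj₂)
import Data.Vec.Functional as Vector
open import Function using (_∘_; id; Equivalence)
open import Function.Bundles using (_↔_; _⇔_; Inverse; Injection; mk⇔; mk↔ₛ′)
open import Function.Properties.Inverse using (↔⇒↣; ↔-sym)
open import Induction.WellFounded using (Acc; acc)
open import Relation.Binary.Definitions using (tri<; tri≈; tri>)
open import Relation.Binary.PropositionalEquality hiding ([_])
open import Relation.Binary.PropositionalEquality.Properties using (setoid)
open import Relation.Nullary using (¬_; yes; no)
open import Relation.Nullary.Decidable using (does; dec-true; dec-false)

open import Defs

open import Algebra.Properties.Semiring.Sum (CommutativeRing.semiring ℚ.+-*-commutativeRing)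
  using (sum; sum-cong-≗; sum-replicate-zero; ∑-distrib-+; ∑-comm; *-distribˡ-sum; *-distribʳ-sum)
open import Algebra.Properties.Semiring.Mult (CommutativeRing.semiring ℚ.+-*-commutativeRing)
  using (×-homo-+; ×1-homo-*) renaming (_×_ to _×ℚ_)

-- Graphs and their rational Laplacian forms

𝟙 : Bool → ℕ
𝟙 b = if b then 1 else 0

record IsSimple {n} (A : Adj n) : Set where
  field
    symmetric   : ∀ i j → A i j ≡ A j i
    irreflexive : ∀ i → A i i ≡ false

Adjacent : ∀ {n} → Adj n → Fin n → Fin n → Set
Adjacent A x y = A x y ≡ true

adjacent⇒≢ : ∀ {n} {A : Adj n} → IsSimple A → ∀ {x y} → Adjacent A x y → x ≢ y
adjacent⇒≢ simple {x} xy refl with () ← trans (sym xy) (IsSimple.irreflexive simple x)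

-- The Laplacian energy of e_u − e_v.
pairEnergy : ∀ {n} → Adj n → Fin n → Fin n → ℕ
pairEnergy A u v = degree A u ℕ.+ degree A v ℕ.+ 2 ℕ.* 𝟙 (A u v)

toℚ : ℕ → ℚ
toℚ n = n ×ℚ 1ℚ

toℚ-+ : ∀ m k → toℚ (m ℕ.+ k) ≡ toℚ m ℚ.+ toℚ k
toℚ-+ = ×-homo-+ 1ℚ

toℚ-* : ∀ m k → toℚ (m ℕ.* k) ≡ toℚ m ℚ.* toℚ k
toℚ-* = ×1-homo-*

toℚ-*₃ : ∀ m k l → toℚ (m ℕ.* k ℕ.* l) ≡ toℚ m ℚ.* toℚ k ℚ.* toℚ l
toℚ-*₃ m k l = trans (toℚ-* (m ℕ.* k) l) (cong (ℚ._* toℚ l) (toℚ-* m k))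

toℚ-nonNeg : ∀ n → 0ℚ ℚ.≤ toℚ n
toℚ-nonNeg zero    = ℚ.≤-refl
toℚ-nonNeg (suc n) = ℚ.+-mono-≤ (ℚ.<⇒≤ (ℚ.positive⁻¹ 1ℚ)) (toℚ-nonNeg n)

toℚ-mono-≤ : ∀ {m n} → m ≤ n → toℚ m ℚ.≤ toℚ n
toℚ-mono-≤ {n = n} z≤n      = toℚ-nonNeg n
toℚ-mono-≤         (s≤s m≤n) = ℚ.+-monoʳ-≤ 1ℚ (toℚ-mono-≤ m≤n)

toℚ-cancel-≤ : ∀ {m n} → toℚ m ℚ.≤ toℚ n → m ≤ n
toℚ-cancel-≤ {m} {n} toℚm≤toℚn with ℕ.≤-<-connex m n
... | inj₁ m≤n = m≤n
... | inj₂ n<m = ⊥-elim (ℚ.<-irrefl refl (begin-strict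
  toℚ n          ≡⟨ ℚ.+-identityˡ (toℚ n) ⟨
  0ℚ ℚ.+ toℚ n   <⟨ ℚ.+-monoˡ-< (toℚ n) (ℚ.positive⁻¹ 1ℚ) ⟩
  toℚ (suc n)    ≤⟨ toℚ-mono-≤ n<m ⟩
  toℚ m          ≤⟨ toℚm≤toℚn ⟩
  toℚ n          ∎))
  where open ℚ.≤-Reasoning

foldr-tabulate : ∀ {A : Set} (_∙_ : A → A → A) (ε : A) {n} (f : Fin n → A) →
                 foldr _∙_ ε (tabulate f) ≡ Vector.foldr _∙_ ε f
foldr-tabulate _∙_ ε {zero}  f = refl
foldr-tabulate _∙_ ε {suc n} f = cong (f zero ∙_) (foldr-tabulate _∙_ ε (f ∘ suc))

sumℚ≡sum : ∀ {n} (f : Fin n → ℚ) → sumℚ f ≡ sum f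
sumℚ≡sum {n} f = trans (cong (foldr ℚ._+_ 0ℚ) (List.map-tabulate id f)) (foldr-tabulate ℚ._+_ 0ℚ f)

toℚ-foldr : ∀ {A : Set} (f : A → ℕ) (xs : List A) →
            toℚ (foldr ℕ._+_ 0 (map f xs)) ≡ foldr ℚ._+_ 0ℚ (map (toℚ ∘ f) xs)
toℚ-foldr f []       = refl
toℚ-foldr f (x ∷ xs) = trans (toℚ-+ (f x) _) (cong (toℚ (f x) ℚ.+_) (toℚ-foldr f xs))

toℚ-degree : ∀ {n} (A : Adj n) i → toℚ (degree A i) ≡ sum (λ j → toℚ (𝟙 (A i j)))
toℚ-degree {n} A i = trans (toℚ-foldr (𝟙 ∘ A i) (allFin n)) (sumℚ≡sum (toℚ ∘ 𝟙 ∘ A i))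

δ : ∀ {n} → Fin n → Fin n → ℚ
δ p i = if does (p Fin.≟ i) then 1ℚ else 0ℚ

sum-δ : ∀ {n} (f : Fin n → ℚ) (p : Fin n) → sum (λ i → f i ℚ.* δ p i) ≡ f p
sum-δ {suc n} f zero = begin
  f zero ℚ.* 1ℚ ℚ.+ sum {n} (λ i → f (suc i) ℚ.* 0ℚ)
    ≡⟨ cong₂ ℚ._+_ (ℚ.*-identityʳ (f zero)) (sum-cong-≗ {n} (ℚ.*-zeroʳ ∘ f ∘ suc)) ⟩
  f zero ℚ.+ sum {n} (λ _ → 0ℚ)                       ≡⟨ cong (f zero ℚ.+_) (sum-replicate-zero n) ⟩
  f zero ℚ.+ 0ℚ                                       ≡⟨ ℚ.+-identityʳ (f zero) ⟩
  f zero                                              ∎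
  where open ≡-Reasoning
sum-δ {suc n} f (suc p) = begin
  f zero ℚ.* 0ℚ ℚ.+ rest   ≡⟨ cong (ℚ._+ rest) (ℚ.*-zeroʳ (f zero)) ⟩
  0ℚ ℚ.+ rest              ≡⟨ ℚ.+-identityˡ rest ⟩
  rest                     ≡⟨ sum-δ (f ∘ suc) p ⟩
  f (suc p)                ∎
  where
  open ≡-Reasoning
  rest : ℚ
  rest = sum {n} (λ i → f (suc i) ℚ.* δ p i)

δ-self : ∀ {n} (p : Fin n) → δ p p ≡ 1ℚ
δ-self p rewrite dec-true (p Fin.≟ p) refl = refl

δ-other : ∀ {n} {p q : Fin n} → p ≢ q → δ p q ≡ 0ℚ
δ-other {p = p} {q} p≢q rewrite dec-false (p Fin.≟ q) p≢q = refl

threePoint : ∀ {n} → Fin n → Fin n → Fin n → ℚ → ℚ → ℚ → Fin n → ℚ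
threePoint u v w α β γ i = α ℚ.* δ u i ℚ.+ β ℚ.* δ v i ℚ.+ γ ℚ.* δ w i

module _ {n} (u v w : Fin n) (α β γ : ℚ) where
  open import Data.Rational using (_+_; _*_)
  open +-*-Solver

  sum-threePoint : ∀ g → sum (λ i → g i * threePoint u v w α β γ i) ≡ α * g u + β * g v + γ * g w
  sum-threePoint g = begin
    sum (λ i → g i * (α * δ u i + β * δ v i + γ * δ w i))
      ≡⟨ sum-cong-≗ (λ i → distrib (g i) (δ u i) (δ v i) (δ w i)) ⟩
    sum (λ i → α * (g i * δ u i) + β * (g i * δ v i) + γ * (g i * δ w i))
      ≡⟨ trans (∑-distrib-+ {n} _ _) (cong (_+ _) (∑-distrib-+ {n} _ _)) ⟩
    sum (λ i → α * (g i * δ u i)) + sum (λ i → β * (g i * δ v i)) + sum (λ i → γ * (g i * δ w i))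
      ≡⟨ cong₂ _+_ (cong₂ _+_ (pull α u) (pull β v)) (pull γ w) ⟩
    α * g u + β * g v + γ * g w ∎
    where
    open ≡-Reasoning
    distrib : ∀ c p q r → c * (α * p + β * q + γ * r) ≡ α * (c * p) + β * (c * q) + γ * (c * r)
    distrib = solve 7 (λ a b e c p q r → c :* (a :* p :+ b :* q :+ e :* r)
                                       := a :* (c :* p) :+ b :* (c :* q) :+ e :* (c :* r)) refl α β γ
    pull : ∀ c p → sum (λ i → c * (g i * δ p i)) ≡ c * g p
    pull c p = trans (sym (*-distribˡ-sum c (λ i → g i * δ p i))) (cong (c *_) (sum-δ g p))

  module _ (u≢v : u ≢ v) (u≢w : u ≢ w) (v≢w : v ≢ w) where
    threePoint-u : threePoint u v w α β γ u ≡ α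
    threePoint-u rewrite δ-self u | δ-other (u≢v ∘ sym) | δ-other (u≢w ∘ sym) =
      solve 3 (λ p q r → p :* con 1ℚ :+ q :* con 0ℚ :+ r :* con 0ℚ := p) refl α β γ

    threePoint-v : threePoint u v w α β γ v ≡ β
    threePoint-v rewrite δ-self v | δ-other u≢v | δ-other (v≢w ∘ sym) =
      solve 3 (λ p q r → p :* con 0ℚ :+ q :* con 1ℚ :+ r :* con 0ℚ := q) refl α β γ

    threePoint-w : threePoint u v w α β γ w ≡ γ
    threePoint-w rewrite δ-self w | δ-other u≢w | δ-other v≢w =
      solve 3 (λ p q r → p :* con 0ℚ :+ q :* con 0ℚ :+ r :* con 1ℚ := r) refl α β γ

testVector : ∀ {n} → Fin n → Fin n → Fin n → ℕ → ℕ → Fin n → ℚ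
testVector u v w k m = threePoint u v w (toℚ k) (ℚ.- toℚ k) (toℚ m)

-- The energy of testVector u v w k m = k (e_u − e_v) + m e_w is testEnergy⁺ − testEnergy⁻ (quadForm-testVector);
-- keeping the two parts apart turns comparisons of energies into inequalities between natural numbers.
testEnergy⁺ testEnergy⁻ : ∀ {n} → Adj n → Fin n → Fin n → Fin n → ℕ → ℕ → ℕ
testEnergy⁺ A u v w k m = k ℕ.* k ℕ.* pairEnergy A u v ℕ.+ m ℕ.* m ℕ.* degree A w ℕ.+ 2 ℕ.* (k ℕ.* m) ℕ.* 𝟙 (A v w)
testEnergy⁻ A u v w k m = 2 ℕ.* (k ℕ.* m) ℕ.* 𝟙 (A u w)

module QuadraticForm {n} {A : Adj n} (simple : IsSimple A) where
  open IsSimple simple renaming (symmetric to A-sym; irreflexive to A-irrefl)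
  open import Data.Rational using (_+_; _*_; _-_; -_)
  open +-*-Solver

  a : Fin n → Fin n → ℚ
  a i j = toℚ (𝟙 (A i j))

  d : Fin n → ℚ
  d i = toℚ (degree A i)

  module _ (x : Fin n → ℚ) where
    sq : Fin n → Fin n → ℚ
    sq i j = (x i - x j) * (x i - x j)

    term : Fin n → Fin n → ℚ
    term i j = if (toℕ i ℕ.<ᵇ toℕ j) ∧ A i j then sq i j else 0ℚ

    private
      one-sided : ∀ b s → (if b then s else 0ℚ) + 0ℚ ≡ toℚ (𝟙 b) * s
      one-sided true  s = trans (ℚ.+-identityʳ s) (sym (ℚ.*-identityˡ s))
      one-sided false s = sym (ℚ.*-zeroˡ s)

      <ᵇ-true : ∀ {m k} → m < k → (m ℕ.<ᵇ k) ≡ true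
      <ᵇ-true {m} {k} = dec-true (m ℕ.<? k)

      <ᵇ-false : ∀ {m k} → ¬ m < k → (m ℕ.<ᵇ k) ≡ false
      <ᵇ-false {m} {k} = dec-false (m ℕ.<? k)

      sq-sym : ∀ i j → sq j i ≡ sq i j
      sq-sym i j = solve 2 (λ p q → (q :- p) :* (q :- p) := (p :- q) :* (p :- q)) refl (x i) (x j)

    term-pair : ∀ i j → term i j + term j i ≡ a i j * sq i j
    term-pair i j with ℕ.<-cmp (toℕ i) (toℕ j)
    ... | tri< i<j _ j≮i rewrite <ᵇ-true i<j | <ᵇ-false j≮i = one-sided (A i j) (sq i j)
    ... | tri> i≮j _ j<i rewrite <ᵇ-false i≮j | <ᵇ-true j<i | A-sym j i =
      trans (ℚ.+-comm 0ℚ (if A i j then sq j i else 0ℚ)) (trans (one-sided (A i j) (sq j i)) (cong (a i j *_) (sq-sym i j)))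
    ... | tri≈ _ i≡j _ rewrite Fin.toℕ-injective i≡j | <ᵇ-false (ℕ.<-irrefl {toℕ j} refl) | A-irrefl j =
      sym (ℚ.*-zeroˡ (sq j j))

    private
      ∑∑ : (Fin n → Fin n → ℚ) → ℚ
      ∑∑ f = sum (λ i → sum (f i))

      ∑∑-+ : ∀ f g → ∑∑ (λ i j → f i j + g i j) ≡ ∑∑ f + ∑∑ g
      ∑∑-+ f g = trans (sum-cong-≗ (λ i → ∑-distrib-+ (f i) (g i))) (∑-distrib-+ (λ i → sum (f i)) (λ i → sum (g i)))

      ∑∑-cong : ∀ {f g} → (∀ i j → f i j ≡ g i j) → ∑∑ f ≡ ∑∑ g
      ∑∑-cong f≡g = sum-cong-≗ (λ i → sum-cong-≗ (f≡g i))

    degreeTerm adjacencyTerm : ℚ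
    degreeTerm = sum (λ i → d i * (x i * x i))
    adjacencyTerm = sum (λ i → x i * sum (λ j → a i j * x j))

    quadForm-double : quadForm A x + quadForm A x ≡ ∑∑ (λ i j → a i j * sq i j)
    quadForm-double = begin
      quadForm A x + quadForm A x                 ≡⟨ cong (λ q → q + q) quadForm≡∑∑ ⟩
      ∑∑ term + ∑∑ term                           ≡⟨ cong (∑∑ term +_) (∑-comm term) ⟩
      ∑∑ term + ∑∑ (λ i j → term j i)             ≡⟨ sym (∑∑-+ term (λ i j → term j i)) ⟩
      ∑∑ (λ i j → term i j + term j i)            ≡⟨ ∑∑-cong term-pair ⟩
      ∑∑ (λ i j → a i j * sq i j)                 ∎
      where
      open ≡-Reasoning
      quadForm≡∑∑ : quadForm A x ≡ ∑∑ term
      quadForm≡∑∑ = trans (sumℚ≡sum (λ i → sumℚ (term i))) (sum-cong-≗ (λ i → sumℚ≡sum (term i)))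

    private
      rows : ∑∑ (λ i j → a i j * (x i * x i)) ≡ degreeTerm
      rows = sum-cong-≗ (λ i → trans (sym (*-distribʳ-sum (x i * x i) (a i))) (cong (_* (x i * x i)) (sym (toℚ-degree A i))))

      columns : ∑∑ (λ i j → a i j * (x j * x j)) ≡ degreeTerm
      columns = trans (∑-comm (λ i j → a i j * (x j * x j)))
                      (trans (∑∑-cong (λ j i → cong (λ b → toℚ (𝟙 b) * (x j * x j)) (A-sym i j))) rows)

      cross : ∑∑ (λ i j → x i * (a i j * x j)) ≡ adjacencyTerm
      cross = sum-cong-≗ (λ i → sym (*-distribˡ-sum (x i) (λ j → a i j * x j)))

      expand : ∀ i j → a i j * sq i j + (x i * (a i j * x j) + x i * (a i j * x j)) ≡ a i j * (x i * x i) + a i j * (x j * x j)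
      expand i j = solve 3 (λ e p q → e :* ((p :- q) :* (p :- q)) :+ (p :* (e :* q) :+ p :* (e :* q))
                                      := e :* (p :* p) :+ e :* (q :* q)) refl (a i j) (x i) (x j)

      doubled : (quadForm A x + quadForm A x) + (adjacencyTerm + adjacencyTerm) ≡ degreeTerm + degreeTerm
      doubled = begin
        (quadForm A x + quadForm A x) + (adjacencyTerm + adjacencyTerm)
          ≡⟨ cong₂ _+_ quadForm-double (sym (cong₂ _+_ cross cross)) ⟩
        ∑∑ (λ i j → a i j * sq i j) + (∑∑ (λ i j → x i * (a i j * x j)) + ∑∑ (λ i j → x i * (a i j * x j)))
          ≡⟨ cong (∑∑ (λ i j → a i j * sq i j) +_) (sym (∑∑-+ _ _)) ⟩
        ∑∑ (λ i j → a i j * sq i j) + ∑∑ (λ i j → x i * (a i j * x j) + x i * (a i j * x j))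
          ≡⟨ sym (∑∑-+ _ _) ⟩
        ∑∑ (λ i j → a i j * sq i j + (x i * (a i j * x j) + x i * (a i j * x j)))
          ≡⟨ ∑∑-cong expand ⟩
        ∑∑ (λ i j → a i j * (x i * x i) + a i j * (x j * x j))
          ≡⟨ ∑∑-+ _ _ ⟩
        ∑∑ (λ i j → a i j * (x i * x i)) + ∑∑ (λ i j → a i j * (x j * x j))
          ≡⟨ cong₂ _+_ rows columns ⟩
        degreeTerm + degreeTerm ∎
        where open ≡-Reasoning

    quadForm-expand : quadForm A x ≡ degreeTerm - adjacencyTerm
    quadForm-expand = halve (quadForm A x) degreeTerm adjacencyTerm doubled
      where
      halve : ∀ q e r → (q + q) + (r + r) ≡ e + e → q ≡ e - r
      halve q e r eq = begin
        q                                     ≡⟨ solve 2 (λ q r → q := con ½ :* (((q :+ q) :+ (r :+ r)) :- (r :+ r))) refl q r ⟩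
        ½ * (((q + q) + (r + r)) - (r + r))   ≡⟨ cong (λ t → ½ * (t - (r + r))) eq ⟩
        ½ * ((e + e) - (r + r))               ≡⟨ solve 2 (λ e r → con ½ :* ((e :+ e) :- (r :+ r)) := e :- r) refl e r ⟩
        e - r                                 ∎
        where open ≡-Reasoning

  module _ {u v w : Fin n} (u≢v : u ≢ v) (u≢w : u ≢ w) (v≢w : v ≢ w) (α β γ : ℚ) where
    private
      x : Fin n → ℚ
      x = threePoint u v w α β γ

      row : Fin n → ℚ
      row p = α * a p u + β * a p v + γ * a p w

      degreeTerm-eval : degreeTerm x ≡ α * (d u * α) + β * (d v * β) + γ * (d w * γ)
      degreeTerm-eval = begin
        sum (λ i → d i * (x i * x i))       ≡⟨ sum-cong-≗ (λ i → sym (ℚ.*-assoc (d i) (x i) (x i))) ⟩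
        sum (λ i → (d i * x i) * x i)       ≡⟨ sum-threePoint u v w α β γ (λ i → d i * x i) ⟩
        α * (d u * x u) + β * (d v * x v) + γ * (d w * x w)
          ≡⟨ cong₂ _+_ (cong₂ _+_ (cong (λ t → α * (d u * t)) (threePoint-u u v w α β γ u≢v u≢w v≢w))
                                  (cong (λ t → β * (d v * t)) (threePoint-v u v w α β γ u≢v u≢w v≢w)))
                       (cong (λ t → γ * (d w * t)) (threePoint-w u v w α β γ u≢v u≢w v≢w)) ⟩
        α * (d u * α) + β * (d v * β) + γ * (d w * γ) ∎
        where open ≡-Reasoning

      adjacencyTerm-eval : adjacencyTerm x ≡ α * row u + β * row v + γ * row w
      adjacencyTerm-eval = begin
        sum (λ i → x i * sum (λ j → a i j * x j))   ≡⟨ sum-cong-≗ (λ i → ℚ.*-comm (x i) _) ⟩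
        sum (λ i → sum (λ j → a i j * x j) * x i)   ≡⟨ sum-threePoint u v w α β γ (λ p → sum (λ j → a p j * x j)) ⟩
        α * sum (λ j → a u j * x j) + β * sum (λ j → a v j * x j) + γ * sum (λ j → a w j * x j)
          ≡⟨ cong₂ _+_ (cong₂ _+_ (cong (α *_) (sum-threePoint u v w α β γ (a u)))
                                  (cong (β *_) (sum-threePoint u v w α β γ (a v))))
                       (cong (γ *_) (sum-threePoint u v w α β γ (a w))) ⟩
        α * row u + β * row v + γ * row w ∎
        where open ≡-Reasoning

      rows-simple : α * row u + β * row v + γ * row w ≡
                    α * (α * 0ℚ + β * a u v + γ * a u w) + β * (α * a u v + β * 0ℚ + γ * a v w) + γ * (α * a u w + β * a v w + γ * 0ℚ)
      rows-simple rewrite A-irrefl u | A-irrefl v | A-irrefl w | A-sym v u | A-sym w u | A-sym w v = refl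

    quadForm-threePoint :
      quadForm A (threePoint u v w α β γ) ≡
        α * α * d u + β * β * d v + γ * γ * d w
          - ((α * β * a u v + α * γ * a u w + β * γ * a v w) + (α * β * a u v + α * γ * a u w + β * γ * a v w))
    quadForm-threePoint = begin
      quadForm A x  ≡⟨ quadForm-expand x ⟩
      degreeTerm x - adjacencyTerm x     ≡⟨ cong₂ _-_ degreeTerm-eval (trans adjacencyTerm-eval rows-simple) ⟩
      α * (d u * α) + β * (d v * β) + γ * (d w * γ)
        - (α * (α * 0ℚ + β * a u v + γ * a u w) + β * (α * a u v + β * 0ℚ + γ * a v w) + γ * (α * a u w + β * a v w + γ * 0ℚ))
                    ≡⟨ collect α β γ (d u) (d v) (d w) (a u v) (a u w) (a v w) ⟩
      α * α * d u + β * β * d v + γ * γ * d w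
        - ((α * β * a u v + α * γ * a u w + β * γ * a v w) + (α * β * a u v + α * γ * a u w + β * γ * a v w)) ∎
      where
      open ≡-Reasoning
      collect : ∀ α β γ du dv dw auv auw avw →
        α * (du * α) + β * (dv * β) + γ * (dw * γ)
          - (α * (α * 0ℚ + β * auv + γ * auw) + β * (α * auv + β * 0ℚ + γ * avw) + γ * (α * auw + β * avw + γ * 0ℚ))
        ≡ α * α * du + β * β * dv + γ * γ * dw
          - ((α * β * auv + α * γ * auw + β * γ * avw) + (α * β * auv + α * γ * auw + β * γ * avw))
      collect = solve 9 (λ α β γ du dv dw auv auw avw →
        α :* (du :* α) :+ β :* (dv :* β) :+ γ :* (dw :* γ)
          :- (α :* (α :* con 0ℚ :+ β :* auv :+ γ :* auw) :+ β :* (α :* auv :+ β :* con 0ℚ :+ γ :* avw)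
              :+ γ :* (α :* auw :+ β :* avw :+ γ :* con 0ℚ))
        := α :* α :* du :+ β :* β :* dv :+ γ :* γ :* dw
          :- ((α :* β :* auv :+ α :* γ :* auw :+ β :* γ :* avw) :+ (α :* β :* auv :+ α :* γ :* auw :+ β :* γ :* avw))) refl

  module _ {u v w : Fin n} (u≢v : u ≢ v) (u≢w : u ≢ w) (v≢w : v ≢ w) (k m : ℕ) where
    quadForm-testVector : quadForm A (testVector u v w k m) + toℚ (testEnergy⁻ A u v w k m) ≡ toℚ (testEnergy⁺ A u v w k m)
    quadForm-testVector = begin
      quadForm A (testVector u v w k m) + toℚ (testEnergy⁻ A u v w k m)
        ≡⟨ cong₂ _+_ (quadForm-threePoint u≢v u≢w v≢w K (- K) M)
                     (trans (toℚ-*₃ 2 (k ℕ.* m) (𝟙 (A u w))) (cong (λ t → two * t * a u w) (toℚ-* k m))) ⟩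
      formula K M (d u) (d v) (d w) (a u v) (a u w) (a v w) + two * (K * M) * a u w
        ≡⟨ regroup K M (d u) (d v) (d w) (a u v) (a u w) (a v w) ⟩
      K * K * (d u + d v + two * a u v) + M * M * d w + two * (K * M) * a v w
        ≡⟨ sym (cong₂ _+_ (cong₂ _+_ (trans (toℚ-*₃ k k (pairEnergy A u v)) (cong (K * K *_) energy))
                                     (toℚ-*₃ m m (degree A w)))
                          (trans (toℚ-*₃ 2 (k ℕ.* m) (𝟙 (A v w))) (cong (λ t → two * t * a v w) (toℚ-* k m)))) ⟩
      toℚ (k ℕ.* k ℕ.* pairEnergy A u v) + toℚ (m ℕ.* m ℕ.* degree A w) + toℚ (2 ℕ.* (k ℕ.* m) ℕ.* 𝟙 (A v w))
        ≡⟨ sym (trans (toℚ-+ (k ℕ.* k ℕ.* pairEnergy A u v ℕ.+ m ℕ.* m ℕ.* degree A w) _)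
                      (cong (_+ _) (toℚ-+ (k ℕ.* k ℕ.* pairEnergy A u v) _))) ⟩
      toℚ (testEnergy⁺ A u v w k m) ∎
      where
      open ≡-Reasoning
      K M two : ℚ
      K = toℚ k
      M = toℚ m
      two = toℚ 2
      energy : toℚ (pairEnergy A u v) ≡ d u + d v + two * a u v
      energy = trans (toℚ-+ (degree A u ℕ.+ degree A v) (2 ℕ.* 𝟙 (A u v)))
                     (cong₂ _+_ (toℚ-+ (degree A u) (degree A v)) (toℚ-* 2 (𝟙 (A u v))))
      formula : ℚ → ℚ → ℚ → ℚ → ℚ → ℚ → ℚ → ℚ → ℚ
      formula K M du dv dw auv auw avw = K * K * du + - K * - K * dv + M * M * dw
          - ((K * - K * auv + K * M * auw + - K * M * avw) + (K * - K * auv + K * M * auw + - K * M * avw))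
      regroup : ∀ K M du dv dw auv auw avw →
        formula K M du dv dw auv auw avw + two * (K * M) * auw ≡ K * K * (du + dv + two * auv) + M * M * dw + two * (K * M) * avw
      regroup = solve 8 (λ K M du dv dw auv auw avw →
        K :* K :* du :+ :- K :* :- K :* dv :+ M :* M :* dw
          :- ((K :* :- K :* auv :+ K :* M :* auw :+ :- K :* M :* avw) :+ (K :* :- K :* auv :+ K :* M :* auw :+ :- K :* M :* avw))
          :+ con two :* (K :* M) :* auw
        := K :* K :* (du :+ dv :+ con two :* auv) :+ M :* M :* dw :+ con two :* (K :* M) :* avw) refl

square-nonNeg : ∀ q → 0ℚ ℚ.≤ q ℚ.* q
square-nonNeg q with ℚ.≤-total 0ℚ q
... | inj₁ 0≤q = ℚ.≤-trans (ℚ.≤-reflexive (sym (ℚ.*-zeroˡ q))) (ℚ.*-monoʳ-≤-nonNeg q {{ℚ.nonNegative 0≤q}} 0≤q)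
... | inj₂ q≤0 = ℚ.≤-trans (ℚ.≤-reflexive (sym (ℚ.*-zeroˡ q))) (ℚ.*-monoʳ-≤-nonPos q {{ℚ.nonPositive q≤0}} q≤0)

sumℚ-mono : ∀ {n} {f g : Fin n → ℚ} → (∀ i → f i ℚ.≤ g i) → sumℚ f ℚ.≤ sumℚ g
sumℚ-mono {n} {f} {g} f≤g = go (allFin n)
  where
  go : ∀ is → foldr ℚ._+_ 0ℚ (map f is) ℚ.≤ foldr ℚ._+_ 0ℚ (map g is)
  go []       = ℚ.≤-refl
  go (i ∷ is) = ℚ.+-mono-≤ (f≤g i) (go is)

quadForm-mono : ∀ {n} {A B : Adj n} → (∀ i j → Adjacent A i j → Adjacent B i j) → ∀ x → quadForm A x ℚ.≤ quadForm B x
quadForm-mono {A = A} {B} A⊆B x = sumℚ-mono (λ i → sumℚ-mono (λ j → term i j))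
  where
  term : ∀ i j → (if (toℕ i ℕ.<ᵇ toℕ j) ∧ A i j then (x i ℚ.- x j) ℚ.* (x i ℚ.- x j) else 0ℚ)
           ℚ.≤ (if (toℕ i ℕ.<ᵇ toℕ j) ∧ B i j then (x i ℚ.- x j) ℚ.* (x i ℚ.- x j) else 0ℚ)
  term i j with toℕ i ℕ.<ᵇ toℕ j | A i j in aij | B i j in bij
  ... | false | _     | _     = ℚ.≤-refl
  ... | true  | false | false = ℚ.≤-refl
  ... | true  | false | true  = square-nonNeg (x i ℚ.- x j)
  ... | true  | true  | true  = ℚ.≤-refl
  ... | true  | true  | false with () ← trans (sym (A⊆B i j aij)) bij

-- Neighbourhoods

lookup-injective : ∀ {A : Set} {xs : List A} → Unique xs → ∀ i j → lookup xs i ≡ lookup xs j → i ≡ j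
lookup-injective (_ ∷ _)      zero    zero    _  = refl
lookup-injective (x∉xs ∷ _)   zero    (suc j) eq = ⊥-elim (All.lookup x∉xs (∈-lookup j) eq)
lookup-injective (x∉xs ∷ _)   (suc i) zero    eq = ⊥-elim (All.lookup x∉xs (∈-lookup i) (sym eq))
lookup-injective (_ ∷ unique) (suc i) (suc j) eq = cong suc (lookup-injective unique i j eq)

length-mono-⊆ : ∀ {A : Set} {xs ys : List A} → Unique xs → xs ⊆ ys → length xs ≤ length ys
length-mono-⊆ {xs = xs} {ys} xs-unique xs⊆ys = Fin.injective⇒≤ position-injective
  where
  position : Fin (length xs) → Fin (length ys)
  position i = Any.index (xs⊆ys (∈-lookup i))
  position-injective : ∀ {i j} → position i ≡ position j → i ≡ j
  position-injective {i} {j} eq = lookup-injective xs-unique i j (begin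
    lookup xs i            ≡⟨ lookup-index (xs⊆ys (∈-lookup i)) ⟩
    lookup ys (position i) ≡⟨ cong (lookup ys) eq ⟩
    lookup ys (position j) ≡⟨ lookup-index (xs⊆ys (∈-lookup j)) ⟨
    lookup xs j            ∎)
    where open ≡-Reasoning

length≤card : ∀ {n} {ys : List (Fin n)} → Unique ys → length ys ≤ n
length≤card {n} {ys} ys-unique = subst (length ys ≤_) (List.length-tabulate id) (length-mono-⊆ ys-unique (λ _ → ∈-allFin _))

two-members : ∀ {A : Set} {ys : List A} → Unique ys → 2 ≤ length ys → ∃₂ λ p q → p ≢ q × p ∈ ys × q ∈ ys
two-members {ys = p ∷ q ∷ _} ((p≢q ∷ _) ∷ _) _ = p , q , p≢q , here refl , there (here refl)
two-members {ys = _ ∷ []} _ (s≤s ())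

module _ {n} (A : Adj n) where

  neighbours : Fin n → List (Fin n)
  neighbours x = filter (λ y → A x y Bool.≟ true) (allFin n)

  neighbours-unique : ∀ x → Unique (neighbours x)
  neighbours-unique x = Unique.filter⁺ (λ y → A x y Bool.≟ true) (Unique.allFin⁺ n)

  ∈-neighbours⁺ : ∀ {x y} → Adjacent A x y → y ∈ neighbours x
  ∈-neighbours⁺ {x} xy = ∈-filter⁺ (λ y → A x y Bool.≟ true) (∈-allFin _) xy

  ∈-neighbours⁻ : ∀ {x y} → y ∈ neighbours x → Adjacent A x y
  ∈-neighbours⁻ {x} y∈ = proj₂ (∈-filter⁻ (λ y → A x y Bool.≟ true) {xs = allFin n} y∈)

  degree≡length-neighbours : ∀ x → degree A x ≡ length (neighbours x)
  degree≡length-neighbours x = count (allFin n)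
    where
    count : ∀ ys → foldr ℕ._+_ 0 (map (𝟙 ∘ A x) ys) ≡ length (filter (λ y → A x y Bool.≟ true) ys)
    count []       = refl
    count (y ∷ ys) with A x y
    ... | true  = cong suc (count ys)
    ... | false = count ys

  degree-≥ : ∀ {x ys} → Unique ys → All (Adjacent A x) ys → length ys ≤ degree A x
  degree-≥ {x} ys-unique adj = subst (_ ≤_) (sym (degree≡length-neighbours x))
    (length-mono-⊆ ys-unique (λ y∈ys → ∈-neighbours⁺ (All.lookup adj y∈ys)))

  degree≡3⇒4≤n : IsSimple A → ∀ {x} → degree A x ≡ 3 → 4 ≤ n
  degree≡3⇒4≤n simple {x} deg≡3 = subst (_≤ n) (cong suc (trans (sym (degree≡length-neighbours x)) deg≡3))
    (length≤card (All.tabulate (adjacent⇒≢ simple ∘ ∈-neighbours⁻) ∷ neighbours-unique x))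

  2≤degree⇒two-neighbours : ∀ {x} → 2 ≤ degree A x → ∃₂ λ p q → p ≢ q × Adjacent A x p × Adjacent A x q
  2≤degree⇒two-neighbours {x} 2≤deg with two-members (neighbours-unique x) (subst (2 ≤_) (degree≡length-neighbours x) 2≤deg)
  ... | p , q , p≢q , p∈ , q∈ = p , q , p≢q , ∈-neighbours⁻ p∈ , ∈-neighbours⁻ q∈

-- The cycle graph

record IsCycleLike {n} (H : Adj n) : Set where
  field
    simple           : IsSimple H
    two-neighbours   : ∀ x → ∃₂ λ y z → y ≢ z × Adjacent H x y × Adjacent H x z
    three-neighbours : ∀ {x y₁ y₂ y₃} → Adjacent H x y₁ → Adjacent H x y₂ → Adjacent H x y₃ →
                       y₁ ≡ y₂ ⊎ y₁ ≡ y₃ ⊎ y₂ ≡ y₃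
    triangle-free    : 4 ≤ n → ∀ {x y z} → Adjacent H x y → Adjacent H y z → Adjacent H x z → ⊥

imageAdj-isCycleLike : ∀ {n} (π : Fin n ↔ Fin n) {A : Adj n} → IsCycleLike A → IsCycleLike (imageAdj π A)
imageAdj-isCycleLike π {A} cyc = record
  { simple           = record { symmetric = λ i j → symmetric (from i) (from j) ; irreflexive = irreflexive ∘ from }
  ; two-neighbours   = λ x → let y , z , y≢z , xy , xz = two-neighbours (from x)
                             in to y , to z , y≢z ∘ to-injective , subst (Adjacent A (from x)) (sym (strictlyInverseʳ y)) xy
                                                                  , subst (Adjacent A (from x)) (sym (strictlyInverseʳ z)) xz
  ; three-neighbours = λ xy₁ xy₂ xy₃ → Sum.map from-injective (Sum.map from-injective from-injective) (three-neighbours xy₁ xy₂ xy₃)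
  ; triangle-free    = λ 4≤n → triangle-free 4≤n
  }
  where
  open Inverse π
  open IsCycleLike cyc
  open IsSimple simple
  to-injective : ∀ {x y} → to x ≡ to y → x ≡ y
  to-injective = Injection.injective (↔⇒↣ π)
  from-injective : ∀ {x y} → from x ≡ from y → x ≡ y
  from-injective = Injection.injective (↔⇒↣ (↔-sym π))

Next : ℕ → ℕ → ℕ → Set
Next n i j = j ≡ suc i ⊎ (suc i ≡ n × j ≡ 0)

CycleStep : ℕ → ℕ → ℕ → Set
CycleStep n i j = Next n i j ⊎ Next n j i

cycleAdj-symmetric : ∀ {n} (a b : Fin n) → cycleAdj n a b ≡ cycleAdj n b a
cycleAdj-symmetric {n} a b = Bool.∨-comm (succModAdj n (toℕ a) (toℕ b)) _

module _ {n : ℕ} where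
  private
    ≡ᵇ-true⇒≡ : ∀ {m k} → (m ℕ.≡ᵇ k) ≡ true → m ≡ k
    ≡ᵇ-true⇒≡ {m} {k} eq = ℕ.≡ᵇ⇒≡ m k (Equivalence.from Bool.T-≡ eq)

    ≡⇒≡ᵇ-true : ∀ {m k} → m ≡ k → (m ℕ.≡ᵇ k) ≡ true
    ≡⇒≡ᵇ-true {m} refl = Equivalence.to Bool.T-≡ (ℕ.≡⇒≡ᵇ m m refl)

  succModAdj⇒Next : ∀ i j → succModAdj n i j ≡ true → Next n i j
  succModAdj⇒Next i j eq with j ℕ.≡ᵇ suc i in j≡1+i | suc i ℕ.≡ᵇ n in 1+i≡n | j ℕ.≡ᵇ 0 in j≡0 | eq
  ... | true  | _     | _     | _ = inj₁ (≡ᵇ-true⇒≡ j≡1+i)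
  ... | false | true  | true  | _ = inj₂ (≡ᵇ-true⇒≡ 1+i≡n , ≡ᵇ-true⇒≡ j≡0)

  Next⇒succModAdj : ∀ i j → Next n i j → succModAdj n i j ≡ true
  Next⇒succModAdj i j (inj₁ j≡1+i) rewrite ≡⇒≡ᵇ-true j≡1+i = refl
  Next⇒succModAdj i j (inj₂ (1+i≡n , j≡0)) rewrite ≡⇒≡ᵇ-true 1+i≡n | ≡⇒≡ᵇ-true j≡0 = Bool.∨-zeroʳ (j ℕ.≡ᵇ suc i)

  cycleAdj⇒CycleStep : ∀ a b → Adjacent (cycleAdj n) a b → CycleStep n (toℕ a) (toℕ b)
  cycleAdj⇒CycleStep a b eq with succModAdj n (toℕ a) (toℕ b) in ab | eq
  ... | true  | _   = inj₁ (succModAdj⇒Next _ _ ab)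
  ... | false | ba  = inj₂ (succModAdj⇒Next _ _ ba)

  CycleStep⇒cycleAdj : ∀ a b → CycleStep n (toℕ a) (toℕ b) → Adjacent (cycleAdj n) a b
  CycleStep⇒cycleAdj a b (inj₁ ab) rewrite Next⇒succModAdj _ _ ab = refl
  CycleStep⇒cycleAdj a b (inj₂ ba) rewrite Next⇒succModAdj _ _ ba = Bool.∨-zeroʳ (succModAdj n (toℕ a) (toℕ b))

  Next-functional : ∀ {i j k} → j < n → k < n → Next n i j → Next n i k → j ≡ k
  Next-functional _   _   (inj₁ j≡1+i)      (inj₁ k≡1+i)      = trans j≡1+i (sym k≡1+i)
  Next-functional j<n _   (inj₁ refl)       (inj₂ (1+i≡n , _)) = ⊥-elim (ℕ.<-irrefl 1+i≡n j<n)
  Next-functional _   k<n (inj₂ (1+i≡n , _)) (inj₁ refl)       = ⊥-elim (ℕ.<-irrefl 1+i≡n k<n)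
  Next-functional _   _   (inj₂ (_ , j≡0))  (inj₂ (_ , k≡0))  = trans j≡0 (sym k≡0)

  Next-injective : ∀ {i j k} → Next n i k → Next n j k → i ≡ j
  Next-injective (inj₁ k≡1+i)       (inj₁ k≡1+j)       = ℕ.suc-injective (trans (sym k≡1+i) k≡1+j)
  Next-injective (inj₁ refl)        (inj₂ (_ , ()))
  Next-injective (inj₂ (_ , refl))  (inj₁ ())
  Next-injective (inj₂ (1+i≡n , _)) (inj₂ (1+j≡n , _)) = ℕ.suc-injective (trans 1+i≡n (sym 1+j≡n))

  Next-irreflexive : 2 ≤ n → ∀ {i} → ¬ Next n i i
  Next-irreflexive _   (inj₁ i≡1+i)         = ℕ.<-irrefl i≡1+i (ℕ.n<1+n _)
  Next-irreflexive 2≤n (inj₂ (1≡n , refl)) = ℕ.<-irrefl 1≡n 2≤n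

  Next-asymmetric : 3 ≤ n → ∀ {i j} → Next n i j → ¬ Next n j i
  Next-asymmetric _   {i} (inj₁ refl)        (inj₁ i≡2+i)       = ℕ.<-irrefl i≡2+i (ℕ.<-trans (ℕ.n<1+n i) (ℕ.n<1+n (suc i)))
  Next-asymmetric 3≤n     (inj₁ refl)        (inj₂ (2≡n , refl)) = ℕ.<-irrefl 2≡n 3≤n
  Next-asymmetric 3≤n     (inj₂ (2≡n , refl)) (inj₁ refl)        = ℕ.<-irrefl 2≡n 3≤n
  Next-asymmetric 3≤n     (inj₂ (1≡n , refl)) (inj₂ (_ , refl))  = ℕ.<-irrefl 1≡n (ℕ.≤-trans (s≤s (s≤s z≤n)) 3≤n)

  private
    wrap-around : 4 ≤ n → ∀ {x z} → suc x ≡ n → Next n 0 z → ¬ Next n z x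
    wrap-around 4≤n 1+x≡n (inj₁ refl) (inj₁ refl)       = ℕ.<-irrefl 1+x≡n 4≤n
    wrap-around 4≤n 1+x≡n (inj₁ refl) (inj₂ (2≡n , _)) = ℕ.<-irrefl 2≡n (ℕ.≤-trans (s≤s (s≤s (s≤s z≤n))) 4≤n)
    wrap-around 4≤n 1+x≡n (inj₂ (1≡n , _)) _           = ℕ.<-irrefl 1≡n (ℕ.≤-trans (s≤s (s≤s z≤n)) 4≤n)

  Next-no-triangle : 4 ≤ n → ∀ {x y z} → Next n x y → Next n y z → ¬ Next n z x
  Next-no-triangle _   {x} (inj₁ refl)          (inj₁ refl)          (inj₁ x≡3+x) =
    ℕ.<-irrefl x≡3+x (s≤s (ℕ.≤-trans (ℕ.n≤1+n x) (ℕ.n≤1+n (suc x))))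
  Next-no-triangle 4≤n     (inj₂ (1+x≡n , refl)) yz                   zx = wrap-around 4≤n 1+x≡n yz zx
  Next-no-triangle 4≤n     (inj₁ xy)            (inj₂ (1+y≡n , refl)) zx = wrap-around 4≤n 1+y≡n zx (inj₁ xy)
  Next-no-triangle 4≤n     (inj₁ xy)            (inj₁ yz)            (inj₂ (1+z≡n , refl)) =
    wrap-around 4≤n 1+z≡n (inj₁ xy) (inj₁ yz)

  next-exists : ∀ {i} → i < n → ∃ λ (b : Fin n) → Next n i (toℕ b)
  next-exists {i} i<n with suc i ℕ.<? n
  ... | yes 1+i<n = Fin.fromℕ< 1+i<n , inj₁ (Fin.toℕ-fromℕ< 1+i<n)
  ... | no  1+i≮n = Fin.fromℕ< 0<n , inj₂ (ℕ.≤-antisym i<n (ℕ.≮⇒≥ 1+i≮n) , Fin.toℕ-fromℕ< 0<n)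
    where
    0<n : 0 < n
    0<n = ℕ.≤-trans (s≤s z≤n) i<n

previous-exists : ∀ {n i} → i < n → ∃ λ (c : Fin n) → Next n (toℕ c) i
previous-exists {suc m} {zero}  _     = Fin.fromℕ< (ℕ.n<1+n m) , inj₂ (cong suc (Fin.toℕ-fromℕ< (ℕ.n<1+n m)) , refl)
previous-exists {n} {suc i} 1+i<n = Fin.fromℕ< i<n , inj₁ (cong suc (sym (Fin.toℕ-fromℕ< i<n)))
  where
  i<n : i < n
  i<n = ℕ.<-trans (ℕ.n<1+n i) 1+i<n

module _ {n : ℕ} where
  private
    CycleStep-three : ∀ {i j k l} → j < n → k < n → l < n → CycleStep n i j → CycleStep n i k → CycleStep n i l →
                      j ≡ k ⊎ j ≡ l ⊎ k ≡ l
    CycleStep-three j<n k<n _   (inj₁ ij) (inj₁ ik) _         = inj₁ (Next-functional j<n k<n ij ik)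
    CycleStep-three _   _   _   (inj₂ ji) (inj₂ ki) _         = inj₁ (Next-injective ji ki)
    CycleStep-three j<n _   l<n (inj₁ ij) (inj₂ _)  (inj₁ il) = inj₂ (inj₁ (Next-functional j<n l<n ij il))
    CycleStep-three _   _   _   (inj₁ _)  (inj₂ ki) (inj₂ li) = inj₂ (inj₂ (Next-injective ki li))
    CycleStep-three _   k<n l<n (inj₂ _)  (inj₁ ik) (inj₁ il) = inj₂ (inj₂ (Next-functional k<n l<n ik il))
    CycleStep-three _   _   _   (inj₂ ji) (inj₁ _)  (inj₂ li) = inj₂ (inj₁ (Next-injective ji li))

  cycleAdj-isCycleLike : 3 ≤ n → IsCycleLike (cycleAdj n)
  cycleAdj-isCycleLike 3≤n = record
    { simple           = simple
    ; two-neighbours   = two-neighbours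
    ; three-neighbours = three-neighbours
    ; triangle-free    = triangle-free
    }
    where
    step : ∀ {a b} → Adjacent (cycleAdj n) a b → CycleStep n (toℕ a) (toℕ b)
    step {a} {b} = cycleAdj⇒CycleStep a b

    irreflexive : ∀ a → cycleAdj n a a ≡ false
    irreflexive a with cycleAdj n a a in aa
    ... | false = refl
    ... | true  = ⊥-elim (Sum.[ irr , irr ] (step {a} {a} aa))
      where
      irr : ∀ {i} → ¬ Next n i i
      irr = Next-irreflexive (ℕ.≤-trans (s≤s (s≤s z≤n)) 3≤n)

    simple : IsSimple (cycleAdj n)
    simple = record { symmetric = cycleAdj-symmetric ; irreflexive = irreflexive }

    two-neighbours : ∀ a → ∃₂ λ b c → b ≢ c × Adjacent (cycleAdj n) a b × Adjacent (cycleAdj n) a c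
    two-neighbours a with next-exists (Fin.toℕ<n a) | previous-exists (Fin.toℕ<n a)
    ... | b , ab | c , ca = b , c , (λ { refl → Next-asymmetric 3≤n ab ca })
                          , CycleStep⇒cycleAdj a b (inj₁ ab) , CycleStep⇒cycleAdj a c (inj₂ ca)

    three-neighbours : ∀ {a b₁ b₂ b₃} → Adjacent (cycleAdj n) a b₁ → Adjacent (cycleAdj n) a b₂ → Adjacent (cycleAdj n) a b₃ →
                       b₁ ≡ b₂ ⊎ b₁ ≡ b₃ ⊎ b₂ ≡ b₃
    three-neighbours {b₁ = b₁} {b₂} {b₃} ab₁ ab₂ ab₃ =
      Sum.map Fin.toℕ-injective (Sum.map Fin.toℕ-injective Fin.toℕ-injective)
        (CycleStep-three (Fin.toℕ<n b₁) (Fin.toℕ<n b₂) (Fin.toℕ<n b₃) (step ab₁) (step ab₂) (step ab₃))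

    triangle-free : 4 ≤ n → ∀ {a b c} → Adjacent (cycleAdj n) a b → Adjacent (cycleAdj n) b c → Adjacent (cycleAdj n) a c → ⊥
    triangle-free 4≤n {a} {b} {c} ab bc ac = go (step ab) (step bc) (step ac)
      where
      ≢ : ∀ {x y} → Adjacent (cycleAdj n) x y → x ≢ y
      ≢ = adjacent⇒≢ simple
      go : CycleStep n (toℕ a) (toℕ b) → CycleStep n (toℕ b) (toℕ c) → CycleStep n (toℕ a) (toℕ c) → ⊥
      go (inj₁ a→b) _          (inj₁ a→c) = ≢ bc (Fin.toℕ-injective (Next-functional (Fin.toℕ<n b) (Fin.toℕ<n c) a→b a→c))
      go (inj₂ b→a) _          (inj₂ c→a) = ≢ bc (Fin.toℕ-injective (Next-injective b→a c→a))
      go (inj₁ a→b) (inj₁ b→c) (inj₂ c→a) = Next-no-triangle 4≤n a→b b→c c→a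
      go (inj₁ a→b) (inj₂ c→b) (inj₂ c→a) = ≢ ab (sym (Fin.toℕ-injective (Next-functional (Fin.toℕ<n b) (Fin.toℕ<n a) c→b c→a)))
      go (inj₂ b→a) (inj₁ b→c) (inj₁ a→c) = ≢ ac (Fin.toℕ-injective (Next-functional (Fin.toℕ<n a) (Fin.toℕ<n c) b→a b→c))
      go (inj₂ b→a) (inj₂ c→b) (inj₁ a→c) = Next-no-triangle 4≤n a→c c→b b→a

-- Cyclic arrangements of a list

module _ {A : Set} where

  data Consecutive : List A → A → A → Set where
    first : ∀ {x y zs} → Consecutive (x ∷ y ∷ zs) x y
    later : ∀ {z zs x y} → Consecutive zs x y → Consecutive (z ∷ zs) x y

  ≡-consecutive : ∀ {L L′ x y} → L ≡ L′ → Consecutive L x y → Consecutive L′ x y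
  ≡-consecutive refl c = c

  consecutive-∈ : ∀ {L x y} → Consecutive L x y → x ∈ L × y ∈ L
  consecutive-∈ first     = here refl , there (here refl)
  consecutive-∈ (later c) = Product.map there there (consecutive-∈ c)

  consecutive-++⁺ˡ : ∀ {P} Q {x y} → Consecutive P x y → Consecutive (P ++ Q) x y
  consecutive-++⁺ˡ Q first     = first
  consecutive-++⁺ˡ Q (later c) = later (consecutive-++⁺ˡ Q c)

  consecutive-++⁺ʳ : ∀ P {Q x y} → Consecutive Q x y → Consecutive (P ++ Q) x y
  consecutive-++⁺ʳ []      c = c
  consecutive-++⁺ʳ (_ ∷ P) c = later (consecutive-++⁺ʳ P c)

  consecutive-split : ∀ P m Q {x y} → Consecutive (P ++ m ∷ Q) x y → Consecutive (P ∷ʳ m) x y ⊎ Consecutive (m ∷ Q) x y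
  consecutive-split []          m Q c         = inj₂ c
  consecutive-split (a ∷ [])    m Q first     = inj₁ first
  consecutive-split (a ∷ [])    m Q (later c) = inj₂ c
  consecutive-split (a ∷ b ∷ P) m Q first     = inj₁ first
  consecutive-split (a ∷ b ∷ P) m Q (later c) = Sum.map₁ later (consecutive-split (b ∷ P) m Q c)

  consecutive-merge : ∀ P m Q {x y} → Consecutive (P ∷ʳ m) x y ⊎ Consecutive (m ∷ Q) x y → Consecutive (P ++ m ∷ Q) x y
  consecutive-merge P m Q (inj₁ c) = ≡-consecutive (List.∷ʳ-++ P m Q) (consecutive-++⁺ˡ Q c)
  consecutive-merge P m Q (inj₂ c) = consecutive-++⁺ʳ P c

  consecutive-decompose : ∀ {L x y} → Consecutive L x y → ∃₂ λ X Y → L ≡ X ++ x ∷ y ∷ Y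
  consecutive-decompose {x ∷ y ∷ zs} first = [] , zs , refl
  consecutive-decompose {z ∷ zs} (later c) with X , Y , eq ← consecutive-decompose c = z ∷ X , Y , cong (z ∷_) eq

  consecutive-reverse : ∀ {L x y} → Consecutive L x y → Consecutive (reverse L) y x
  consecutive-reverse {x ∷ y ∷ zs} first = ≡-consecutive (sym reverse-xyzs) (consecutive-++⁺ʳ (reverse zs) first)
    where
    reverse-xyzs : reverse (x ∷ y ∷ zs) ≡ reverse zs ++ y ∷ x ∷ []
    reverse-xyzs = trans (List.unfold-reverse x (y ∷ zs)) (trans (cong (_∷ʳ x) (List.unfold-reverse y zs)) (List.++-assoc (reverse zs) [ y ] [ x ]))
  consecutive-reverse {z ∷ zs} (later c) = ≡-consecutive (sym (List.unfold-reverse z zs)) (consecutive-++⁺ˡ [ z ] (consecutive-reverse c))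

  consecutive-∷ʳ⁻ : ∀ L z {x y} → Consecutive (L ∷ʳ z) x y → Consecutive L x y ⊎ (∃ λ L′ → L ≡ L′ ∷ʳ x × y ≡ z)
  consecutive-∷ʳ⁻ []          z (later ())
  consecutive-∷ʳ⁻ (a ∷ [])    z first          = inj₂ ([] , refl , refl)
  consecutive-∷ʳ⁻ (a ∷ [])    z (later (later ()))
  consecutive-∷ʳ⁻ (a ∷ b ∷ L) z first          = inj₁ first
  consecutive-∷ʳ⁻ (a ∷ b ∷ L) z (later c) with consecutive-∷ʳ⁻ (b ∷ L) z c
  ... | inj₁ c′                 = inj₁ (later c′)
  ... | inj₂ (L′ , eq , refl)   = inj₂ (a ∷ L′ , cong (a ∷_) eq , refl)

  Cyclic : List A → A → A → Set
  Cyclic []      _ _ = ⊥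
  Cyclic (h ∷ t) x y = Consecutive (h ∷ t ∷ʳ h) x y

  ≡-cyclic : ∀ {K K′ x y} → K ≡ K′ → Cyclic K x y → Cyclic K′ x y
  ≡-cyclic refl c = c

  PathEdge CycleEdge : List A → A → A → Set
  PathEdge  P x y = Consecutive P x y ⊎ Consecutive P y x
  CycleEdge K x y = Cyclic K x y ⊎ Cyclic K y x

  private
    closed-walk : ∀ (p : A) P q Q → (p ∷ P ++ q ∷ Q) ∷ʳ p ≡ (p ∷ P) ++ q ∷ (Q ∷ʳ p)
    closed-walk p P q Q = cong (p ∷_) (List.++-assoc P (q ∷ Q) [ p ])

  cyclic-arcs⁻ : ∀ p P q Q {x y} → Cyclic (p ∷ P ++ q ∷ Q) x y → Consecutive (p ∷ P ∷ʳ q) x y ⊎ Consecutive (q ∷ Q ∷ʳ p) x y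
  cyclic-arcs⁻ p P q Q c = consecutive-split (p ∷ P) q (Q ∷ʳ p) (≡-consecutive (closed-walk p P q Q) c)

  cyclic-arcs⁺ : ∀ p P q Q {x y} → Consecutive (p ∷ P ∷ʳ q) x y ⊎ Consecutive (q ∷ Q ∷ʳ p) x y → Cyclic (p ∷ P ++ q ∷ Q) x y
  cyclic-arcs⁺ p P q Q arcs = ≡-consecutive (sym (closed-walk p P q Q)) (consecutive-merge (p ∷ P) q (Q ∷ʳ p) arcs)

  cyclic-rotate : ∀ P Q {x y} → Cyclic (P ++ Q) x y → Cyclic (Q ++ P) x y
  cyclic-rotate []      Q       c = ≡-cyclic (sym (List.++-identityʳ Q)) c
  cyclic-rotate (p ∷ P) []      c = ≡-cyclic (List.++-identityʳ (p ∷ P)) c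
  cyclic-rotate (p ∷ P) (q ∷ Q) c = cyclic-arcs⁺ q Q p P (Sum.swap (cyclic-arcs⁻ p P q Q c))

  cycleEdge-rotate : ∀ P Q {x y} → CycleEdge (P ++ Q) x y → CycleEdge (Q ++ P) x y
  cycleEdge-rotate P Q = Sum.map (cyclic-rotate P Q) (cyclic-rotate P Q)

  rotate-to-front : ∀ {K u v} → u ≢ v → Cyclic K u v → ∃₂ λ P Q → K ≡ P ++ Q × ∃ λ M → Q ++ P ≡ v ∷ M ∷ʳ u
  rotate-to-front {h ∷ t} {u} {v} u≢v c with consecutive-∷ʳ⁻ (h ∷ t) h c
  ... | inj₂ ([]     , refl , refl) = ⊥-elim (u≢v refl)
  ... | inj₂ (_ ∷ M  , refl , refl) = [] , h ∷ t , refl , M , List.++-identityʳ (h ∷ t)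
  ... | inj₁ c′ with X , Y , eq ← consecutive-decompose c′ =
    X ∷ʳ u , v ∷ Y , trans eq (sym (List.∷ʳ-++ X u (v ∷ Y))) , Y ++ X , cong (v ∷_) (sym (List.++-assoc Y X [ u ]))

  split-at-step : ∀ {M u v p q} → p ≢ v → q ≢ u → q ≢ v → Cyclic (v ∷ M ∷ʳ u) p q →
                  ∃₂ λ X Y → v ∷ M ∷ʳ u ≡ (v ∷ X ∷ʳ p) ++ (q ∷ Y ∷ʳ u)
  split-at-step {M} {u} {v} {p} {q} p≢v q≢u q≢v c with consecutive-∷ʳ⁻ (v ∷ M ∷ʳ u) v c
  ... | inj₂ (_ , _ , q≡v) = ⊥-elim (q≢v q≡v)
  ... | inj₁ c′ with consecutive-decompose c′
  ...   | []     , _ , eq = ⊥-elim (p≢v (sym (List.∷-injectiveˡ eq)))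
  ...   | _ ∷ X , Y , eq with refl , M∷ʳu≡ ← List.∷-injective eq with List.initLast Y
  ...     | [] = ⊥-elim (q≢u (sym (List.∷ʳ-injectiveʳ M (X ∷ʳ p) (trans M∷ʳu≡ (sym (List.∷ʳ-++ X p [ q ]))))))
  ...     | Y′ ∷ʳ′ y
    with refl ← List.∷ʳ-injectiveʳ M (X ++ p ∷ q ∷ Y′) (trans M∷ʳu≡ (sym (List.++-assoc X (p ∷ q ∷ Y′) [ y ]))) =
    X , Y′ , cong (v ∷_) (trans M∷ʳu≡ (sym (List.++-assoc X [ p ] (q ∷ Y′ ∷ʳ y))))

  Link : A → A → A → A → Set
  Link a b x y = (x ≡ a × y ≡ b) ⊎ (x ≡ b × y ≡ a)

  private
    snoc-snoc : ∀ L (m z : A) → L ∷ʳ m ∷ʳ z ≡ L ++ m ∷ z ∷ []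
    snoc-snoc L m z = List.∷ʳ-++ L m [ z ]

  consecutive-∷ʳ∷ʳ⁻ : ∀ L m z {x y} → Consecutive (L ∷ʳ m ∷ʳ z) x y → Consecutive (L ∷ʳ m) x y ⊎ (x ≡ m × y ≡ z)
  consecutive-∷ʳ∷ʳ⁻ L m z c with consecutive-split L m [ z ] (≡-consecutive (snoc-snoc L m z) c)
  ... | inj₁ c′   = inj₁ c′
  ... | inj₂ first = inj₂ (refl , refl)
  ... | inj₂ (later (later ()))

  consecutive-∷ʳ∷ʳ⁺ : ∀ L m z {x y} → Consecutive (L ∷ʳ m) x y ⊎ (x ≡ m × y ≡ z) → Consecutive (L ∷ʳ m ∷ʳ z) x y
  consecutive-∷ʳ∷ʳ⁺ L m z (inj₁ c)             = consecutive-++⁺ˡ [ z ] c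
  consecutive-∷ʳ∷ʳ⁺ L m z (inj₂ (refl , refl)) = ≡-consecutive (sym (snoc-snoc L m z)) (consecutive-merge L m [ z ] (inj₂ first))

  cyclic-glue⁻ : ∀ a P b c Q d {x y} → Cyclic ((a ∷ P ∷ʳ b) ++ (c ∷ Q ∷ʳ d)) x y →
                 Consecutive (a ∷ P ∷ʳ b) x y ⊎ Consecutive (c ∷ Q ∷ʳ d) x y ⊎ (x ≡ b × y ≡ c) ⊎ (x ≡ d × y ≡ a)
  cyclic-glue⁻ a P b c Q d step with cyclic-arcs⁻ a (P ∷ʳ b) c (Q ∷ʳ d) step
  ... | inj₁ arc = Sum.[ inj₁ , inj₂ ∘ inj₂ ∘ inj₁ ]′ (consecutive-∷ʳ∷ʳ⁻ (a ∷ P) b c arc)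
  ... | inj₂ arc = Sum.[ inj₂ ∘ inj₁ , inj₂ ∘ inj₂ ∘ inj₂ ]′ (consecutive-∷ʳ∷ʳ⁻ (c ∷ Q) d a arc)

  cyclic-glue⁺ : ∀ a P b c Q d {x y} →
                 Consecutive (a ∷ P ∷ʳ b) x y ⊎ Consecutive (c ∷ Q ∷ʳ d) x y ⊎ (x ≡ b × y ≡ c) ⊎ (x ≡ d × y ≡ a) →
                 Cyclic ((a ∷ P ∷ʳ b) ++ (c ∷ Q ∷ʳ d)) x y
  cyclic-glue⁺ a P b c Q d = cyclic-arcs⁺ a (P ∷ʳ b) c (Q ∷ʳ d) ∘ Sum.[ inj₁ ∘ first-arc ∘ inj₁ , Sum.[ inj₂ ∘ second-arc ∘ inj₁ ,
                                                                   Sum.[ inj₁ ∘ first-arc ∘ inj₂ , inj₂ ∘ second-arc ∘ inj₂ ]′ ]′ ]′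
    where
    first-arc : ∀ {x y} → Consecutive (a ∷ P ∷ʳ b) x y ⊎ (x ≡ b × y ≡ c) → Consecutive (a ∷ P ∷ʳ b ∷ʳ c) x y
    first-arc = consecutive-∷ʳ∷ʳ⁺ (a ∷ P) b c
    second-arc : ∀ {x y} → Consecutive (c ∷ Q ∷ʳ d) x y ⊎ (x ≡ d × y ≡ a) → Consecutive (c ∷ Q ∷ʳ d ∷ʳ a) x y
    second-arc = consecutive-∷ʳ∷ʳ⁺ (c ∷ Q) d a

  Unique-resp-↭ : ∀ {K K′ : List A} → K ↭ K′ → Unique K → Unique K′
  Unique-resp-↭ K↭K′ = PermSetoid.Unique-resp-↭ (setoid A) (↭⇒↭ₛ K↭K′)

  unique-++-disjoint : ∀ (P : List A) {Q x} → Unique (P ++ Q) → x ∈ P → x ∈ Q → ⊥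
  unique-++-disjoint (_ ∷ P) (x∉ ∷ _)      (here refl) x∈Q = All.lookup (AllP.++⁻ʳ P x∉) x∈Q refl
  unique-++-disjoint (_ ∷ P) (_ ∷ unique) (there x∈P) x∈Q = unique-++-disjoint P unique x∈P x∈Q

  cycleEdge-glue⁻ : ∀ (a : A) P b c Q d {x y} → CycleEdge ((a ∷ P ∷ʳ b) ++ (c ∷ Q ∷ʳ d)) x y →
                    PathEdge (a ∷ P ∷ʳ b) x y ⊎ PathEdge (c ∷ Q ∷ʳ d) x y ⊎ Link b c x y ⊎ Link d a x y
  cycleEdge-glue⁻ a P b c Q d (inj₁ xy) = Sum.map inj₁ (Sum.map inj₁ (Sum.map inj₁ inj₁)) (cyclic-glue⁻ a P b c Q d xy)
  cycleEdge-glue⁻ a P b c Q d (inj₂ yx) =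
    Sum.map inj₂ (Sum.map inj₂ (Sum.map (inj₂ ∘ Product.swap) (inj₂ ∘ Product.swap))) (cyclic-glue⁻ a P b c Q d yx)

  cycleEdge-glue⁺ : ∀ (a : A) P b c Q d {x y} →
                    PathEdge (a ∷ P ∷ʳ b) x y ⊎ PathEdge (c ∷ Q ∷ʳ d) x y ⊎ Link b c x y ⊎ Link d a x y →
                    CycleEdge ((a ∷ P ∷ʳ b) ++ (c ∷ Q ∷ʳ d)) x y
  cycleEdge-glue⁺ a P b c Q d (inj₁ (inj₁ xy))                   = inj₁ (cyclic-glue⁺ a P b c Q d (inj₁ xy))
  cycleEdge-glue⁺ a P b c Q d (inj₁ (inj₂ yx))                   = inj₂ (cyclic-glue⁺ a P b c Q d (inj₁ yx))
  cycleEdge-glue⁺ a P b c Q d (inj₂ (inj₁ (inj₁ xy)))            = inj₁ (cyclic-glue⁺ a P b c Q d (inj₂ (inj₁ xy)))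
  cycleEdge-glue⁺ a P b c Q d (inj₂ (inj₁ (inj₂ yx)))            = inj₂ (cyclic-glue⁺ a P b c Q d (inj₂ (inj₁ yx)))
  cycleEdge-glue⁺ a P b c Q d (inj₂ (inj₂ (inj₁ (inj₁ xy))))     = inj₁ (cyclic-glue⁺ a P b c Q d (inj₂ (inj₂ (inj₁ xy))))
  cycleEdge-glue⁺ a P b c Q d (inj₂ (inj₂ (inj₁ (inj₂ yx))))     = inj₂ (cyclic-glue⁺ a P b c Q d (inj₂ (inj₂ (inj₁ (Product.swap yx)))))
  cycleEdge-glue⁺ a P b c Q d (inj₂ (inj₂ (inj₂ (inj₁ xy))))     = inj₁ (cyclic-glue⁺ a P b c Q d (inj₂ (inj₂ (inj₂ xy))))
  cycleEdge-glue⁺ a P b c Q d (inj₂ (inj₂ (inj₂ (inj₂ yx))))     = inj₂ (cyclic-glue⁺ a P b c Q d (inj₂ (inj₂ (inj₂ (Product.swap yx)))))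

  pathEdge-reverse : ∀ {L : List A} {x y} → PathEdge L x y → PathEdge (reverse L) x y
  pathEdge-reverse = Sum.swap ∘ Sum.map consecutive-reverse consecutive-reverse

  pathEdge-reverse⁻ : ∀ {L : List A} {x y} → PathEdge (reverse L) x y → PathEdge L x y
  pathEdge-reverse⁻ {L} = subst (λ L′ → PathEdge L′ _ _) (List.reverse-involutive L) ∘ pathEdge-reverse

module MissingEdges {A : Set} (G : A → A → Bool) where

  missing : A → A → ℕ
  missing x y = if G x y then 0 else 1

  badSteps : List A → ℕ
  badSteps (x ∷ y ∷ L) = missing x y ℕ.+ badSteps (y ∷ L)
  badSteps _           = 0

  badSteps-split : ∀ P m Q → badSteps (P ++ m ∷ Q) ≡ badSteps (P ∷ʳ m) ℕ.+ badSteps (m ∷ Q)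
  badSteps-split []          m Q = refl
  badSteps-split (a ∷ [])    m Q = cong (ℕ._+ badSteps (m ∷ Q)) (sym (ℕ.+-identityʳ (missing a m)))
  badSteps-split (a ∷ b ∷ P) m Q = trans (cong (missing a b ℕ.+_) (badSteps-split (b ∷ P) m Q)) (sym (ℕ.+-assoc (missing a b) _ _))

  badSteps-∷ʳ∷ʳ : ∀ L m z → badSteps (L ∷ʳ m ∷ʳ z) ≡ badSteps (L ∷ʳ m) ℕ.+ missing m z
  badSteps-∷ʳ∷ʳ L m z = trans (cong badSteps (List.∷ʳ-++ L m [ z ]))
                              (trans (badSteps-split L m [ z ]) (cong (badSteps (L ∷ʳ m) ℕ.+_) (ℕ.+-identityʳ (missing m z))))

  badSteps-reverse : (∀ x y → G x y ≡ G y x) → ∀ L → badSteps (reverse L) ≡ badSteps L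
  badSteps-reverse G-sym (x ∷ y ∷ L) = begin
    badSteps (reverse (x ∷ y ∷ L))             ≡⟨ cong badSteps (List.unfold-reverse x (y ∷ L)) ⟩
    badSteps (reverse (y ∷ L) ∷ʳ x)            ≡⟨ cong (λ R → badSteps (R ∷ʳ x)) (List.unfold-reverse y L) ⟩
    badSteps (reverse L ∷ʳ y ∷ʳ x)             ≡⟨ badSteps-∷ʳ∷ʳ (reverse L) y x ⟩
    badSteps (reverse L ∷ʳ y) ℕ.+ missing y x  ≡⟨ cong₂ ℕ._+_ (trans (cong badSteps (sym (List.unfold-reverse y L))) (badSteps-reverse G-sym (y ∷ L)))
                                                              (cong (λ b → if b then 0 else 1) (G-sym y x)) ⟩
    badSteps (y ∷ L) ℕ.+ missing x y           ≡⟨ ℕ.+-comm _ (missing x y) ⟩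
    badSteps (x ∷ y ∷ L)                       ∎
    where open ≡-Reasoning
  badSteps-reverse G-sym []      = refl
  badSteps-reverse G-sym (x ∷ []) = refl

  badCycle : List A → ℕ
  badCycle []      = 0
  badCycle (h ∷ t) = badSteps (h ∷ t ∷ʳ h)

  badCycle-arcs : ∀ p P q Q → badCycle (p ∷ P ++ q ∷ Q) ≡ badSteps (p ∷ P ∷ʳ q) ℕ.+ badSteps (q ∷ Q ∷ʳ p)
  badCycle-arcs p P q Q = trans (cong badSteps (cong (p ∷_) (List.++-assoc P (q ∷ Q) [ p ]))) (badSteps-split (p ∷ P) q (Q ∷ʳ p))

  badCycle-rotate : ∀ P Q → badCycle (P ++ Q) ≡ badCycle (Q ++ P)
  badCycle-rotate []      Q       = cong badCycle (sym (List.++-identityʳ Q))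
  badCycle-rotate (p ∷ P) []      = cong badCycle (List.++-identityʳ (p ∷ P))
  badCycle-rotate (p ∷ P) (q ∷ Q) = trans (badCycle-arcs p P q Q) (trans (ℕ.+-comm (badSteps (p ∷ P ∷ʳ q)) _) (sym (badCycle-arcs q Q p P)))

  badCycle-glue : ∀ a P b c Q d → badCycle ((a ∷ P ∷ʳ b) ++ (c ∷ Q ∷ʳ d)) ≡
                  (badSteps (a ∷ P ∷ʳ b) ℕ.+ missing b c) ℕ.+ (badSteps (c ∷ Q ∷ʳ d) ℕ.+ missing d a)
  badCycle-glue a P b c Q d =
    trans (badCycle-arcs a (P ∷ʳ b) c (Q ∷ʳ d)) (cong₂ ℕ._+_ (badSteps-∷ʳ∷ʳ (a ∷ P) b c) (badSteps-∷ʳ∷ʳ (c ∷ Q) d a))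

-- Bad edges, squares and the 2-opt exchange

module Squares {A : Set} (G : A → A → Bool) where

  Bad : (A → A → Set) → A → A → Set
  Bad H x y = H x y × G x y ≡ false

  Side : (A → A → Set) → A → A → A → Set
  Side H x y w = (G x w ≡ true × ¬ H x w) × (G y w ≡ true × ¬ H y w)

  -- w and z complete x, y to a 4-cycle x w y z of G whose diagonal wz is bad and whose sides are not in H.
  record Square (H : A → A → Set) (x y : A) : Set where
    constructor square
    field
      {w z}  : A
      bad-wz : Bad H w z
      side-w : Side H x y w
      side-z : Side H x y z

  -- The structure that L_H ≼ L_G forces on the bad edges and that the 2-opt exchange preserves.
  record Invariant (H : A → A → Set) : Set where
    field
      irreflexive : ∀ x → ¬ H x x
      square-of   : ∀ {x y} → Bad H x y → Square H x y
      bad-unique  : ∀ {x y y′} → Bad H x y → Bad H x y′ → y ≡ y′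

  Invariant-resp : ∀ {H H′} → (∀ {x y} → H x y → H′ x y) → (∀ {x y} → H′ x y → H x y) → Invariant H → Invariant H′
  Invariant-resp {H} {H′} to from inv = record
    { irreflexive = λ x → irreflexive x ∘ from
    ; square-of   = λ (h , g) → transport (square-of (from h , g))
    ; bad-unique  = λ (h₁ , g₁) (h₂ , g₂) → bad-unique (from h₁ , g₁) (from h₂ , g₂)
    }
    where
    open Invariant inv
    side : ∀ {x y w} → Side H x y w → Side H′ x y w
    side ((gxw , ¬hxw) , (gyw , ¬hyw)) = (gxw , ¬hxw ∘ from) , (gyw , ¬hyw ∘ from)
    transport : ∀ {x y} → Square H x y → Square H′ x y
    transport (square (h , g) side-w side-z) = square (to h , g) (side side-w) (side side-z)

  module Exchange
    (G-sym : ∀ x y → G x y ≡ G y x) (G-irreflexive : ∀ x → G x x ≡ false)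
    (max-degree-3 : ∀ {x ps} → Unique ps → All (λ p → G x p ≡ true) ps → List.length ps ≤ 3)
    {H H′ : A → A → Set} (H-sym : ∀ {x y} → H x y → H y x) (H′-sym : ∀ {x y} → H′ x y → H′ y x)
    (inv : Invariant H) {u v p q : A} (bad-uv : Bad H u v) (bad-pq : Bad H p q)
    (up : G u p ≡ true) (uq : G u q ≡ true) (vp : G v p ≡ true) (vq : G v q ≡ true)
    where

    corners : List A
    corners = u ∷ v ∷ p ∷ q ∷ []

    -- H′ trades the bad edges uv, pq of H for the G-edges pu, qv and keeps every edge away from the corners.
    Exchanged : Set
    Exchanged = (∀ {x y} → H′ x y → H x y ⊎ Link p u x y ⊎ Link q v x y)
              × ¬ H′ u v × ¬ H′ p q
              × (∀ {x y} → x ∉ corners → y ∉ corners → H x y → H′ x y)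

    private
      open Invariant inv

      H-≢ : ∀ {x y} → H x y → x ≢ y
      H-≢ h refl = irreflexive _ h

      bad-sym : ∀ {x y} → Bad H x y → Bad H y x
      bad-sym {x} {y} (h , g) = H-sym h , trans (G-sym y x) g

      no-four-neighbours : ∀ {c a b x y} → a ≢ b → x ∉ a ∷ b ∷ [] → y ∉ a ∷ b ∷ [] → x ≢ y →
                           G c a ≡ true → G c b ≡ true → G c x ≡ true → G c y ≡ true → ⊥
      no-four-neighbours {a = a} {b} {x} {y} a≢b x∉ y∉ x≢y ca cb cx cy with max-degree-3 distinct (ca ∷ cb ∷ cx ∷ cy ∷ [])
        where
        distinct : Unique (a ∷ b ∷ x ∷ y ∷ [])
        distinct = (a≢b ∷ (λ a≡x → x∉ (here (sym a≡x))) ∷ (λ a≡y → y∉ (here (sym a≡y))) ∷ [])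
                 ∷ ((λ b≡x → x∉ (there (here (sym b≡x)))) ∷ (λ b≡y → y∉ (there (here (sym b≡y)))) ∷ [])
                 ∷ (x≢y ∷ []) ∷ [] ∷ []
      ... | s≤s (s≤s (s≤s ()))

      side-outside : ∀ {x y w} → x ∉ corners → y ∉ corners → x ≢ y → Side H x y w → w ∉ corners
      side-outside {x} {y} x∉ y∉ x≢y ((xw , _) , (yw , _)) = λ where
          (here refl)                         → around-pq up uq xw yw
          (there (here refl))                 → around-pq vp vq xw yw
          (there (there (here refl)))         → around-uv (trans (G-sym p u) up) (trans (G-sym p v) vp) xw yw
          (there (there (there (here refl)))) → around-uv (trans (G-sym q u) uq) (trans (G-sym q v) vq) xw yw
        where
        around-pq : ∀ {c} → G c p ≡ true → G c q ≡ true → G x c ≡ true → G y c ≡ true → ⊥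
        around-pq {c} cp cq xc yc = no-four-neighbours (H-≢ (proj₁ bad-pq)) (x∉ ∘ there ∘ there) (y∉ ∘ there ∘ there) x≢y
                                      cp cq (trans (G-sym c x) xc) (trans (G-sym c y) yc)
        around-uv : ∀ {c} → G c u ≡ true → G c v ≡ true → G x c ≡ true → G y c ≡ true → ⊥
        around-uv {c} cu cv xc yc = no-four-neighbours (H-≢ (proj₁ bad-uv)) (x∉ ∘ ∈-++⁺ˡ) (y∉ ∘ ∈-++⁺ˡ) x≢y
                                      cu cv (trans (G-sym c x) xc) (trans (G-sym c y) yc)

    invariant-exchange : Exchanged → Invariant H′
    invariant-exchange (H′⊆ , ¬uv , ¬pq , kept) = record
      { irreflexive = irreflexive′
      ; square-of   = square-of′
      ; bad-unique  = λ b₁ b₂ → bad-unique (bad⇐ b₁) (bad⇐ b₂)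
      }
      where
      link-G : ∀ {x y} → Link p u x y ⊎ Link q v x y → G x y ≡ true
      link-G (inj₁ (inj₁ (refl , refl))) = trans (G-sym p u) up
      link-G (inj₁ (inj₂ (refl , refl))) = up
      link-G (inj₂ (inj₁ (refl , refl))) = trans (G-sym q v) vq
      link-G (inj₂ (inj₂ (refl , refl))) = vq

      link-corner : ∀ {x y} → Link p u x y ⊎ Link q v x y → x ∈ corners
      link-corner (inj₁ (inj₁ (refl , _))) = there (there (here refl))
      link-corner (inj₁ (inj₂ (refl , _))) = here refl
      link-corner (inj₂ (inj₁ (refl , _))) = there (there (there (here refl)))
      link-corner (inj₂ (inj₂ (refl , _))) = there (here refl)

      irreflexive′ : ∀ x → ¬ H′ x x
      irreflexive′ x h′ with H′⊆ h′
      ... | inj₁ h = irreflexive x h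
      ... | inj₂ l with () ← trans (sym (link-G l)) (G-irreflexive x)

      bad⇐ : ∀ {x y} → Bad H′ x y → Bad H x y
      bad⇐ (h′ , g) with H′⊆ h′
      ... | inj₁ h = h , g
      ... | inj₂ l with () ← trans (sym (link-G l)) g

      bad-outside : ∀ {x y} → Bad H′ x y → x ∉ corners
      bad-outside b′ (here refl)                         = ¬uv (subst (H′ u) (bad-unique (bad⇐ b′) bad-uv) (proj₁ b′))
      bad-outside b′ (there (here refl))                 = ¬uv (H′-sym (subst (H′ v) (bad-unique (bad⇐ b′) (bad-sym bad-uv)) (proj₁ b′)))
      bad-outside b′ (there (there (here refl)))         = ¬pq (subst (H′ p) (bad-unique (bad⇐ b′) bad-pq) (proj₁ b′))
      bad-outside b′ (there (there (there (here refl)))) = ¬pq (H′-sym (subst (H′ q) (bad-unique (bad⇐ b′) (bad-sym bad-pq)) (proj₁ b′)))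

      side′ : ∀ {x y w} → x ∉ corners → y ∉ corners → Side H x y w → Side H′ x y w
      side′ x∉ y∉ ((xw , ¬xw) , (yw , ¬yw)) =
        (xw , Sum.[ ¬xw , x∉ ∘ link-corner ]′ ∘ H′⊆) , (yw , Sum.[ ¬yw , y∉ ∘ link-corner ]′ ∘ H′⊆)

      square-of′ : ∀ {x y} → Bad H′ x y → Square H′ x y
      square-of′ {x} {y} b′@(h′ , g) with square-of (bad⇐ b′)
      ... | square {w} {z} (hwz , gwz) side-w side-z = square (kept w∉ z∉ hwz , gwz) (side′ x∉ y∉ side-w) (side′ x∉ y∉ side-z)
        where
        x∉ : x ∉ corners
        x∉ = bad-outside b′
        y∉ : y ∉ corners
        y∉ = bad-outside (H′-sym h′ , trans (G-sym y x) g)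
        x≢y : x ≢ y
        x≢y = H-≢ (proj₁ (bad⇐ b′))
        w∉ : w ∉ corners
        w∉ = side-outside x∉ y∉ x≢y side-w
        z∉ : z ∉ corners
        z∉ = side-outside x∉ y∉ x≢y side-z

module HamiltonianSearch {A : Set} (G : A → A → Bool)
  (G-sym : ∀ x y → G x y ≡ G y x) (G-irreflexive : ∀ x → G x x ≡ false)
  (max-degree-3 : ∀ {x ps} → Unique ps → All (λ p → G x p ≡ true) ps → List.length ps ≤ 3) where

  open Squares G
  open MissingEdges G

  -- Reversing the arc q ⋯ u of the cycle v ⋯ p q ⋯ u replaces its edges pq and uv by pu and qv.
  module TwoOptMove (X Y : List A) (u v p q : A) where
    S T before after : List A
    S      = v ∷ X ∷ʳ p
    T      = q ∷ Y ∷ʳ u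
    before = S ++ T
    after  = S ++ (u ∷ reverse Y ∷ʳ q)

    reverse-T : reverse T ≡ u ∷ reverse Y ∷ʳ q
    reverse-T = trans (List.unfold-reverse q (Y ∷ʳ u)) (cong (_∷ʳ q) (List.reverse-++ Y [ u ]))

    after↭before : after ↭ before
    after↭before = Perm.++⁺ˡ S (↭-trans (↭-reflexive (sym reverse-T)) (Perm.↭-reverse T))

    private
      reversed : ∀ {x y} → PathEdge (u ∷ reverse Y ∷ʳ q) x y → PathEdge T x y
      reversed = pathEdge-reverse⁻ ∘ subst (λ L → PathEdge L _ _) (sym reverse-T)

      unreversed : ∀ {x y} → PathEdge T x y → PathEdge (u ∷ reverse Y ∷ʳ q) x y
      unreversed = subst (λ L → PathEdge L _ _) reverse-T ∘ pathEdge-reverse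

    after⇒before : ∀ {x y} → CycleEdge after x y → CycleEdge before x y ⊎ Link p u x y ⊎ Link q v x y
    after⇒before e with cycleEdge-glue⁻ v X p u (reverse Y) q e
    ... | inj₁ s               = inj₁ (cycleEdge-glue⁺ v X p q Y u (inj₁ s))
    ... | inj₂ (inj₁ t)        = inj₁ (cycleEdge-glue⁺ v X p q Y u (inj₂ (inj₁ (reversed t))))
    ... | inj₂ (inj₂ (inj₁ l)) = inj₂ (inj₁ l)
    ... | inj₂ (inj₂ (inj₂ l)) = inj₂ (inj₂ l)

    before⇒after : ∀ {x y} → x ∉ u ∷ v ∷ p ∷ q ∷ [] → CycleEdge before x y → CycleEdge after x y
    before⇒after x∉ e with cycleEdge-glue⁻ v X p q Y u e
    ... | inj₁ s                           = cycleEdge-glue⁺ v X p u (reverse Y) q (inj₁ s)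
    ... | inj₂ (inj₁ t)                    = cycleEdge-glue⁺ v X p u (reverse Y) q (inj₂ (inj₁ (unreversed t)))
    ... | inj₂ (inj₂ (inj₁ (inj₁ (refl , _)))) = ⊥-elim (x∉ (there (there (here refl))))
    ... | inj₂ (inj₂ (inj₁ (inj₂ (refl , _)))) = ⊥-elim (x∉ (there (there (there (here refl)))))
    ... | inj₂ (inj₂ (inj₂ (inj₁ (refl , _)))) = ⊥-elim (x∉ (here refl))
    ... | inj₂ (inj₂ (inj₂ (inj₂ (refl , _)))) = ⊥-elim (x∉ (there (here refl)))

    module _ (unique : Unique before) (u≢v : u ≢ v) (p≢q : p ≢ q) (u≢p : u ≢ p) (u≢q : u ≢ q) (v≢p : v ≢ p) (v≢q : v ≢ q) where
      private
        disjoint : ∀ {x} → x ∈ S → x ∈ T → ⊥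
        disjoint = unique-++-disjoint S unique
        v∈S : v ∈ S
        v∈S = here refl
        p∈S : p ∈ S
        p∈S = there (∈-++⁺ʳ X (here refl))
        q∈T : q ∈ T
        q∈T = here refl
        u∈T : u ∈ T
        u∈T = there (∈-++⁺ʳ Y (here refl))
        in-S : ∀ {x y} → PathEdge S x y → x ∈ S × y ∈ S
        in-S = Sum.[ consecutive-∈ , Product.swap ∘ consecutive-∈ ]′
        in-T : ∀ {x y} → PathEdge T x y → x ∈ T × y ∈ T
        in-T = Sum.[ consecutive-∈ , Product.swap ∘ consecutive-∈ ]′

      uv∉after : ¬ CycleEdge after u v
      uv∉after e with cycleEdge-glue⁻ v X p u (reverse Y) q e
      ... | inj₁ s                               = disjoint (proj₁ (in-S s)) u∈T
      ... | inj₂ (inj₁ t)                        = disjoint v∈S (proj₂ (in-T (reversed t)))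
      ... | inj₂ (inj₂ (inj₁ (inj₁ (u≡p , _))))  = u≢p u≡p
      ... | inj₂ (inj₂ (inj₁ (inj₂ (_ , v≡p))))  = v≢p v≡p
      ... | inj₂ (inj₂ (inj₂ (inj₁ (u≡q , _))))  = u≢q u≡q
      ... | inj₂ (inj₂ (inj₂ (inj₂ (u≡v , _))))  = u≢v u≡v

      pq∉after : ¬ CycleEdge after p q
      pq∉after e with cycleEdge-glue⁻ v X p u (reverse Y) q e
      ... | inj₁ s                               = disjoint (proj₂ (in-S s)) q∈T
      ... | inj₂ (inj₁ t)                        = disjoint p∈S (proj₁ (in-T (reversed t)))
      ... | inj₂ (inj₂ (inj₁ (inj₁ (_ , q≡u))))  = u≢q (sym q≡u)
      ... | inj₂ (inj₂ (inj₁ (inj₂ (p≡u , _))))  = u≢p (sym p≡u)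
      ... | inj₂ (inj₂ (inj₂ (inj₁ (p≡q , _))))  = p≢q p≡q
      ... | inj₂ (inj₂ (inj₂ (inj₂ (p≡v , _))))  = v≢p (sym p≡v)

    badCycle-after<before : G p q ≡ false → G u v ≡ false → G p u ≡ true → G q v ≡ true → badCycle after < badCycle before
    badCycle-after<before pq uv pu qv
      rewrite badCycle-glue v X p u (reverse Y) q | badCycle-glue v X p q Y u
            | trans (cong badSteps (sym reverse-T)) (badSteps-reverse G-sym T) | pq | uv | pu | qv =
      ℕ.+-mono-< (ℕ.+-monoʳ-< (badSteps S) (s≤s z≤n)) (ℕ.+-monoʳ-< (badSteps T) (s≤s z≤n))

  Improvement : List A → Set
  Improvement K = ∃ λ K′ → K′ ↭ K × badCycle K′ < badCycle K × Invariant (CycleEdge K′)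

  private
    G-≢ : ∀ {x y} → G x y ≡ true → x ≢ y
    G-≢ {x} xy refl with () ← trans (sym xy) (G-irreflexive x)

  exchange-improves : ∀ {X Y u v p q} → let open TwoOptMove X Y u v p q in
    Unique before → Invariant (CycleEdge before) → G u v ≡ false → G p q ≡ false →
    Side (CycleEdge before) u v p → Side (CycleEdge before) u v q → Improvement before
  exchange-improves {X} {Y} {u} {v} {p} {q} unique inv uv pq ((up , _) , (vp , _)) ((uq , _) , (vq , _)) =
    after , after↭before , badCycle-after<before pq uv (trans (G-sym p u) up) (trans (G-sym q v) vq) ,
    Exchange.invariant-exchange G-sym G-irreflexive max-degree-3 Sum.swap Sum.swap inv bad-uv bad-pq up uq vp vq
      (after⇒before , uv∉after unique u≢v p≢q (G-≢ up) (G-≢ uq) (G-≢ vp) (G-≢ vq)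
                    , pq∉after unique u≢v p≢q (G-≢ up) (G-≢ uq) (G-≢ vp) (G-≢ vq) , λ x∉ _ → before⇒after x∉)
    where
    open TwoOptMove X Y u v p q
    bad-uv : Bad (CycleEdge before) u v
    bad-uv = inj₁ (cyclic-glue⁺ v X p q Y u (inj₂ (inj₂ (inj₂ (refl , refl))))) , uv
    bad-pq : Bad (CycleEdge before) p q
    bad-pq = inj₁ (cyclic-glue⁺ v X p q Y u (inj₂ (inj₂ (inj₁ (refl , refl))))) , pq
    u≢v : u ≢ v
    u≢v refl = Invariant.irreflexive inv u (proj₁ bad-uv)
    p≢q : p ≢ q
    p≢q refl = Invariant.irreflexive inv p (proj₁ bad-pq)

  private
    improve-oriented : ∀ {M u v p q} → Unique (v ∷ M ∷ʳ u) → Invariant (CycleEdge (v ∷ M ∷ʳ u)) →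
                       G u v ≡ false → Cyclic (v ∷ M ∷ʳ u) p q → G p q ≡ false →
                       Side (CycleEdge (v ∷ M ∷ʳ u)) u v p → Side (CycleEdge (v ∷ M ∷ʳ u)) u v q → Improvement (v ∷ M ∷ʳ u)
    improve-oriented {M} {u} {v} {p} {q} unique inv uv p→q pq side-p@(_ , (vp , _)) side-q@((uq , _) , (vq , _))
      with X , Y , eq ← split-at-step (G-≢ vp ∘ sym) (G-≢ uq ∘ sym) (G-≢ vq ∘ sym) p→q =
      subst Improvement (sym eq)
        (exchange-improves (subst Unique eq unique) (subst (Invariant ∘ CycleEdge) eq inv) uv pq
                           (subst (λ K → Side (CycleEdge K) u v p) eq side-p) (subst (λ K → Side (CycleEdge K) u v q) eq side-q))

    improve-at-wrap : ∀ {M u v} → Unique (v ∷ M ∷ʳ u) → Invariant (CycleEdge (v ∷ M ∷ʳ u)) → G u v ≡ false →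
                      Improvement (v ∷ M ∷ʳ u)
    improve-at-wrap {M} {u} {v} unique inv uv with Invariant.square-of inv (inj₁ wrap , uv)
      where
      wrap : Cyclic (v ∷ M ∷ʳ u) u v
      wrap = consecutive-∷ʳ∷ʳ⁺ (v ∷ M) u v (inj₂ (refl , refl))
    ... | square {w} {z} (inj₁ w→z , wz) side-w side-z = improve-oriented unique inv uv w→z wz side-w side-z
    ... | square {w} {z} (inj₂ z→w , wz) side-w side-z = improve-oriented unique inv uv z→w (trans (G-sym z w) wz) side-z side-w

  improve : ∀ {K u v} → Unique K → Invariant (CycleEdge K) → Cyclic K u v → G u v ≡ false → Improvement K
  improve {K} {u} {v} unique inv u→v uv with rotate-to-front (λ { refl → Invariant.irreflexive inv u (inj₁ u→v) }) u→v
  ... | P , Q , refl , M , eq with improve-at-wrap (subst Unique eq (Unique-resp-↭ (Perm.++-comm P Q) unique))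
                                                   (subst (Invariant ∘ CycleEdge) eq (Invariant-resp (cycleEdge-rotate P Q) (cycleEdge-rotate Q P) inv)) uv
  ...   | K′ , K′↭ , K′< , inv′ =
    K′ , ↭-trans K′↭ (↭-trans (↭-reflexive (sym eq)) (Perm.++-comm Q P)) ,
    subst (badCycle K′ <_) (trans (cong badCycle (sym eq)) (badCycle-rotate Q P)) K′< , inv′

  private
    path-good-or-bad : ∀ L → (∀ {x y} → Consecutive L x y → G x y ≡ true) ⊎ ∃₂ λ x y → Consecutive L x y × G x y ≡ false
    path-good-or-bad []          = inj₁ λ ()
    path-good-or-bad (x ∷ [])    = inj₁ λ { (later ()) }
    path-good-or-bad (x ∷ y ∷ L) with G x y in xy | path-good-or-bad (y ∷ L)
    ... | false | _                     = inj₂ (x , y , first , xy)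
    ... | true  | inj₂ (a , b , ab , g) = inj₂ (a , b , later ab , g)
    ... | true  | inj₁ good             = inj₁ λ { first → xy ; (later c) → good c }

    cyclic-good-or-bad : ∀ K → (∀ {x y} → Cyclic K x y → G x y ≡ true) ⊎ ∃₂ λ x y → Cyclic K x y × G x y ≡ false
    cyclic-good-or-bad []      = inj₁ λ ()
    cyclic-good-or-bad (h ∷ t) = path-good-or-bad (h ∷ t ∷ʳ h)

  hamiltonian-arrangement : ∀ K → Unique K → Invariant (CycleEdge K) →
                            ∃ λ K* → K* ↭ K × (∀ {x y} → Cyclic K* x y → G x y ≡ true)
  hamiltonian-arrangement K = go K (ℕ.<-wellFounded (badCycle K))
    where
    go : ∀ K → Acc _<_ (badCycle K) → Unique K → Invariant (CycleEdge K) →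
         ∃ λ K* → K* ↭ K × (∀ {x y} → Cyclic K* x y → G x y ≡ true)
    go K (acc smaller) unique inv with cyclic-good-or-bad K
    ... | inj₁ good = K , ↭-refl , good
    ... | inj₂ (u , v , u→v , uv) with K′ , K′↭K , K′< , inv′ ← improve unique inv u→v uv
                                  with K* , K*↭K′ , good ← go K′ (smaller K′<) (Unique-resp-↭ (↭-sym K′↭K) unique) inv′ =
      K* , ↭-trans K*↭K′ K′↭K , good

-- Consequences of L_H ≼ L_G

module LaplacianDominance {n} {G H : Adj n} (G-simple : IsSimple G) (G-cubic : ∀ i → degree G i ≤ 3)
                            (H-cycle : IsCycleLike H) (H≼G : ∀ x → quadForm H x ℚ.≤ quadForm G x) where
  open IsCycleLike H-cycle renaming (simple to H-simple)
  open Squares G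

  private
    module QG = QuadraticForm G-simple
    module QH = QuadraticForm H-simple

    G-≢ : ∀ {x y} → Adjacent G x y → x ≢ y
    G-≢ = adjacent⇒≢ G-simple

    H-≢ : ∀ {x y} → Adjacent H x y → x ≢ y
    H-≢ = adjacent⇒≢ H-simple

    G-sym : ∀ {x y} → Adjacent G x y → Adjacent G y x
    G-sym {x} {y} = trans (IsSimple.symmetric G-simple y x)

    H-sym : ∀ {x y} → Adjacent H x y → Adjacent H y x
    H-sym {x} {y} = trans (IsSimple.symmetric H-simple y x)

  laplacian-test : ∀ {u v w} → u ≢ v → u ≢ w → v ≢ w → ∀ k m →
    testEnergy⁺ H u v w k m ℕ.+ testEnergy⁻ G u v w k m ≤ testEnergy⁺ G u v w k m ℕ.+ testEnergy⁻ H u v w k m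
  laplacian-test {u} {v} {w} u≢v u≢w v≢w k m = toℚ-cancel-≤ (begin
    toℚ (P H ℕ.+ N G)                          ≡⟨ toℚ-+ (P H) (N G) ⟩
    toℚ (P H) ℚ.+ toℚ (N G)                    ≡⟨ cong (ℚ._+ toℚ (N G)) (QH.quadForm-testVector u≢v u≢w v≢w k m) ⟨
    quadForm H x ℚ.+ toℚ (N H) ℚ.+ toℚ (N G)   ≡⟨ ℚ.+-assoc (quadForm H x) (toℚ (N H)) (toℚ (N G)) ⟩
    quadForm H x ℚ.+ (toℚ (N H) ℚ.+ toℚ (N G)) ≤⟨ ℚ.+-monoˡ-≤ (toℚ (N H) ℚ.+ toℚ (N G)) (H≼G x) ⟩
    quadForm G x ℚ.+ (toℚ (N H) ℚ.+ toℚ (N G)) ≡⟨ shuffle (quadForm G x) (toℚ (N H)) (toℚ (N G)) ⟩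
    quadForm G x ℚ.+ toℚ (N G) ℚ.+ toℚ (N H)   ≡⟨ cong (ℚ._+ toℚ (N H)) (QG.quadForm-testVector u≢v u≢w v≢w k m) ⟩
    toℚ (P G) ℚ.+ toℚ (N H)                    ≡⟨ toℚ-+ (P G) (N H) ⟨
    toℚ (P G ℕ.+ N H)                          ∎)
    where
    open ℚ.≤-Reasoning
    open +-*-Solver
    x : Fin n → ℚ
    x = testVector u v w k m
    P N : Adj n → ℕ
    P A = testEnergy⁺ A u v w k m
    N A = testEnergy⁻ A u v w k m
    shuffle : ∀ q a b → q ℚ.+ (a ℚ.+ b) ≡ q ℚ.+ b ℚ.+ a
    shuffle = solve 3 (λ q a b → q :+ (a :+ b) := q :+ b :+ a) refl

  pairEnergy-≤ : ∀ {u v w} → u ≢ v → u ≢ w → v ≢ w → pairEnergy H u v ≤ pairEnergy G u v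
  pairEnergy-≤ u≢v u≢w v≢w = subst₂ _≤_ (drop-zeros _) (drop-zeros _) (laplacian-test u≢v u≢w v≢w 1 0)
    where
    drop-zeros : ∀ e → 1 ℕ.* e ℕ.+ 0 ℕ.+ 0 ℕ.+ 0 ≡ e
    drop-zeros = solve-∀

  private
    third-vertex : ∀ u v → ∃ λ w → u ≢ w × v ≢ w
    third-vertex u v with y , z , y≢z , uy , uz ← two-neighbours u with v Fin.≟ y
    ... | yes refl = z , H-≢ uz , y≢z
    ... | no  v≢y  = y , H-≢ uy , v≢y

    2≤degree-H : ∀ x → 2 ≤ degree H x
    2≤degree-H x with y , z , y≢z , xy , xz ← two-neighbours x = degree-≥ H ((y≢z ∷ []) ∷ [] ∷ []) (xy ∷ xz ∷ [])

    tight : ∀ {a b c d} → 2 ≤ a → 2 ≤ b → c ≤ 3 → d ≤ 3 → a ℕ.+ b ℕ.+ 2 ≤ c ℕ.+ d ℕ.+ 0 →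
            c ℕ.+ d ℕ.+ 0 ≤ a ℕ.+ b ℕ.+ 2 × c ≡ 3
    tight {a} {b} {c} {d} 2≤a 2≤b c≤3 d≤3 le = ℕ.≤-trans at-most-6 at-least-6 , ℕ.≤-antisym c≤3 3≤c
      where
      at-least-6 : 6 ≤ a ℕ.+ b ℕ.+ 2
      at-least-6 = ℕ.+-monoˡ-≤ 2 (ℕ.+-mono-≤ 2≤a 2≤b)
      at-most-6 : c ℕ.+ d ℕ.+ 0 ≤ 6
      at-most-6 = ℕ.+-monoˡ-≤ 0 (ℕ.+-mono-≤ c≤3 d≤3)
      3≤c : 3 ≤ c
      3≤c = ℕ.+-cancelʳ-≤ d 3 c (ℕ.≤-trans (ℕ.+-monoʳ-≤ 3 d≤3)
              (subst (6 ≤_) (ℕ.+-identityʳ (c ℕ.+ d)) (ℕ.≤-trans at-least-6 le)))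

    balance-arith : ∀ {E E′ d d′ x y x′ y′} → E′ ≤ E → d′ ≤ 3 →
      4 ℕ.* E ℕ.+ 1 ℕ.* d ℕ.+ 4 ℕ.* x ℕ.+ 4 ℕ.* y ≤ 4 ℕ.* E′ ℕ.+ 1 ℕ.* d′ ℕ.+ 4 ℕ.* x′ ℕ.+ 4 ℕ.* y′ →
      x ℕ.+ y ≤ x′ ℕ.+ y′
    balance-arith {E} {E′} {d} {d′} {x} {y} {x′} {y′} E′≤E d′≤3 le =
      ℕ.≤-pred (ℕ.*-cancelˡ-< 4 (x ℕ.+ y) (suc (x′ ℕ.+ y′)) (begin-strict
        4 ℕ.* (x ℕ.+ y)                   ≤⟨ ℕ.m≤n+m _ d ⟩
        d ℕ.+ 4 ℕ.* (x ℕ.+ y)             ≤⟨ ℕ.+-cancelˡ-≤ (4 ℕ.* E) _ _ cancelled ⟩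
        3 ℕ.+ 4 ℕ.* (x′ ℕ.+ y′)           <⟨ ℕ.n<1+n _ ⟩
        4 ℕ.+ 4 ℕ.* (x′ ℕ.+ y′)           ≡⟨ ℕ.*-suc 4 (x′ ℕ.+ y′) ⟨
        4 ℕ.* suc (x′ ℕ.+ y′)             ∎))
      where
      open ℕ.≤-Reasoning
      regroup : ∀ E d x y → 4 ℕ.* E ℕ.+ 1 ℕ.* d ℕ.+ 4 ℕ.* x ℕ.+ 4 ℕ.* y ≡ 4 ℕ.* E ℕ.+ (d ℕ.+ 4 ℕ.* (x ℕ.+ y))
      regroup = solve-∀
      cancelled : 4 ℕ.* E ℕ.+ (d ℕ.+ 4 ℕ.* (x ℕ.+ y)) ≤ 4 ℕ.* E ℕ.+ (3 ℕ.+ 4 ℕ.* (x′ ℕ.+ y′))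
      cancelled = begin
        4 ℕ.* E ℕ.+ (d ℕ.+ 4 ℕ.* (x ℕ.+ y))       ≡⟨ regroup E d x y ⟨
        4 ℕ.* E ℕ.+ 1 ℕ.* d ℕ.+ 4 ℕ.* x ℕ.+ 4 ℕ.* y ≤⟨ le ⟩
        4 ℕ.* E′ ℕ.+ 1 ℕ.* d′ ℕ.+ 4 ℕ.* x′ ℕ.+ 4 ℕ.* y′ ≡⟨ regroup E′ d′ x′ y′ ⟩
        4 ℕ.* E′ ℕ.+ (d′ ℕ.+ 4 ℕ.* (x′ ℕ.+ y′))   ≤⟨ ℕ.+-mono-≤ (ℕ.*-monoʳ-≤ 4 E′≤E) (ℕ.+-monoˡ-≤ _ d′≤3) ⟩
        4 ℕ.* E ℕ.+ (3 ℕ.+ 4 ℕ.* (x′ ℕ.+ y′))     ∎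

  bad-tight : ∀ {u v} → Bad (Adjacent H) u v → pairEnergy G u v ≤ pairEnergy H u v × degree G u ≡ 3
  bad-tight {u} {v} (uv , ¬uv) with w , u≢w , v≢w ← third-vertex u v =
    Product.map₁ (subst₂ _≤_ (cong (energy G) (sym ¬uv)) (cong (energy H) (sym uv)))
      (tight (2≤degree-H u) (2≤degree-H v) (G-cubic u) (G-cubic v)
             (subst₂ _≤_ (cong (energy H) uv) (cong (energy G) ¬uv) (pairEnergy-≤ (H-≢ uv) u≢w v≢w)))
    where
    energy : Adj n → Bool → ℕ
    energy A b = degree A u ℕ.+ degree A v ℕ.+ 2 ℕ.* 𝟙 b

  -- bad-tight makes e_u − e_v a zero, hence a kernel vector, of the nonnegative form of L_G − L_H. The test
  -- vector 2 (e_u − e_v) + e_w shows that the w-coordinate of (L_G − L_H)(e_u − e_v) is nonnegative; by the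
  -- symmetry in u and v it vanishes.
  balance : ∀ {u v w} → Bad (Adjacent H) u v → u ≢ w → v ≢ w → 𝟙 (H v w) ℕ.+ 𝟙 (G u w) ≤ 𝟙 (G v w) ℕ.+ 𝟙 (H u w)
  balance {u} {v} {w} bad@(uv , _) u≢w v≢w =
    balance-arith {pairEnergy H u v} {pairEnergy G u v} {degree H w} {degree G w} {𝟙 (H v w)} {𝟙 (G u w)} {𝟙 (G v w)} {𝟙 (H u w)}
                  (proj₁ (bad-tight bad)) (G-cubic w) (laplacian-test (H-≢ uv) u≢w v≢w 2 1)

  private
    ≡false⇒≢true : ∀ {b} → b ≡ false → b ≢ true
    ≡false⇒≢true refl ()

    bad-sym : ∀ {u v} → Bad (Adjacent H) u v → Bad (Adjacent H) v u
    bad-sym {u} {v} (uv , ¬uv) = H-sym uv , trans (IsSimple.symmetric G-simple v u) ¬uv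

  side-transfer : ∀ {u v w} → Bad (Adjacent H) u v → u ≢ w → v ≢ w →
                  Adjacent G u w → H u w ≡ false → Adjacent G v w × H v w ≡ false
  side-transfer {u} {v} {w} bad u≢w v≢w uw ¬uw =
    bits (subst₂ (λ g h → 𝟙 (H v w) ℕ.+ 𝟙 g ≤ 𝟙 (G v w) ℕ.+ 𝟙 h) uw ¬uw (balance bad u≢w v≢w))
    where
    bits : ∀ {a b} → 𝟙 a ℕ.+ 1 ≤ 𝟙 b ℕ.+ 0 → b ≡ true × a ≡ false
    bits {false} {true} _          = refl , refl
    bits {true}  {true} (s≤s ())

  diagonal-transfer : ∀ {u v w} → Bad (Adjacent H) u v → u ≢ w → v ≢ w →
                      G u w ≡ false → Adjacent H u w → G v w ≡ false × Adjacent H v w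
  diagonal-transfer {u} {v} {w} bad u≢w v≢w ¬uw uw =
    bits (subst₂ (λ h g → 𝟙 h ℕ.+ 𝟙 (G v w) ≤ 𝟙 g ℕ.+ 𝟙 (H v w)) uw ¬uw (balance (bad-sym bad) v≢w u≢w))
    where
    bits : ∀ {a b} → 1 ℕ.+ 𝟙 a ≤ 0 ℕ.+ 𝟙 b → a ≡ false × b ≡ true
    bits {false} {true} _          = refl , refl
    bits {true}  {true} (s≤s ())

  private
    side : ∀ {u v w} → Bad (Adjacent H) u v → Adjacent G u w → H u w ≡ false → Side (Adjacent H) u v w
    side {u} {v} {w} bad@(_ , ¬uv) uw ¬huw =
      (uw , ≡false⇒≢true ¬huw) , Product.map₂ ≡false⇒≢true (side-transfer bad (G-≢ uw) v≢w uw ¬huw)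
      where
      v≢w : v ≢ w
      v≢w refl = ≡false⇒≢true ¬uv uw

  side-exists : ∀ {u v} → Bad (Adjacent H) u v → ∃ (Side (Adjacent H) u v)
  side-exists {u} {v} bad@(uv , ¬uv) =
    choose (2≤degree⇒two-neighbours G {u} (ℕ.≤-trans (s≤s (s≤s z≤n)) (ℕ.≤-reflexive (sym (proj₂ (bad-tight bad))))))
    where
    choose : (∃₂ λ p q → p ≢ q × Adjacent G u p × Adjacent G u q) → ∃ (Side (Adjacent H) u v)
    choose (p , q , p≢q , up , uq) with H u p Bool.≟ true | H u q Bool.≟ true
    ... | no ¬hup | _       = p , side bad up (Bool.¬-not ¬hup)
    ... | yes _   | no ¬huq = q , side bad uq (Bool.¬-not ¬huq)
    ... | yes hup | yes huq with three-neighbours uv hup huq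
    ...   | inj₁ refl        = ⊥-elim (≡false⇒≢true ¬uv up)
    ...   | inj₂ (inj₁ refl) = ⊥-elim (≡false⇒≢true ¬uv uq)
    ...   | inj₂ (inj₂ p≡q)  = ⊥-elim (p≢q p≡q)

  private
    square-at : ∀ {u v w z} → Side (Adjacent H) u v w → Adjacent H w z → G w z ≡ false → Square (Adjacent H) u v
    square-at {u} {v} {w} {z} side-w@((uw , ¬huw) , (vw , ¬hvw)) wz ¬wz = square (wz , ¬wz) side-w (through uw ¬huw , through vw ¬hvw)
      where
      through : ∀ {x} → Adjacent G x w → ¬ Adjacent H x w → Adjacent G x z × ¬ Adjacent H x z
      through {x} xw ¬hxw = Product.map G-sym (λ ¬zx → ≡false⇒≢true ¬zx ∘ H-sym)
                              (side-transfer (wz , ¬wz) (G-≢ (G-sym xw)) z≢x (G-sym xw) (Bool.¬-not (¬hxw ∘ H-sym)))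
        where
        z≢x : z ≢ x
        z≢x refl = ¬hxw (H-sym wz)

  square-exists : ∀ {u v} → Bad (Adjacent H) u v → Square (Adjacent H) u v
  square-exists {u} {v} bad@(uv , _) = from-side (side-exists bad)
    where
    from-side : ∃ (Side (Adjacent H) u v) → Square (Adjacent H) u v
    from-side (w , side-w@((uw , ¬huw) , (vw , ¬hvw))) = from-neighbours (two-neighbours w)
      where
      from-neighbours : (∃₂ λ s₁ s₂ → s₁ ≢ s₂ × Adjacent H w s₁ × Adjacent H w s₂) → Square (Adjacent H) u v
      from-neighbours (s₁ , s₂ , s₁≢s₂ , ws₁ , ws₂) with G w s₁ Bool.≟ true | G w s₂ Bool.≟ true
      ... | no ¬ws₁ | _       = square-at side-w ws₁ (Bool.¬-not ¬ws₁)
      ... | yes _   | no ¬ws₂ = square-at side-w ws₂ (Bool.¬-not ¬ws₂)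
      ... | yes gs₁ | yes gs₂ =
        ⊥-elim (ℕ.<-irrefl refl (ℕ.≤-trans (degree-≥ G distinct (G-sym uw ∷ G-sym vw ∷ gs₁ ∷ gs₂ ∷ [])) (G-cubic w)))
        where
        distinct : Unique (u ∷ v ∷ s₁ ∷ s₂ ∷ [])
        distinct = (H-≢ uv ∷ (λ { refl → ¬huw (H-sym ws₁) }) ∷ (λ { refl → ¬huw (H-sym ws₂) }) ∷ [])
                 ∷ ((λ { refl → ¬hvw (H-sym ws₁) }) ∷ (λ { refl → ¬hvw (H-sym ws₂) }) ∷ [])
                 ∷ (s₁≢s₂ ∷ []) ∷ [] ∷ []

  bad-unique : ∀ {x y y′} → Bad (Adjacent H) x y → Bad (Adjacent H) x y′ → y ≡ y′
  bad-unique {x} {y} {y′} bad@(xy , _) (xy′ , ¬xy′) with y Fin.≟ y′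
  ... | yes y≡y′ = y≡y′
  ... | no  y≢y′ = ⊥-elim (triangle-free (degree≡3⇒4≤n G G-simple (proj₂ (bad-tight bad))) xy
                                         (proj₂ (diagonal-transfer bad (H-≢ xy′) y≢y′ ¬xy′ xy′)) xy′)

  invariant : Invariant (Adjacent H)
  invariant = record
    { irreflexive = λ x xx → H-≢ xx refl
    ; square-of   = square-exists
    ; bad-unique  = bad-unique
    }

-- Arrangements of Fin n

module _ {A : Set} where

  private
    consecutive-tabulate⁺ : ∀ {n} (f : Fin n → A) {a b} → toℕ b ≡ suc (toℕ a) → Consecutive (tabulate f) (f a) (f b)
    consecutive-tabulate⁺ f {zero}  {suc zero}    _ = first
    consecutive-tabulate⁺ f {suc a} {suc b}       e = later (consecutive-tabulate⁺ (f ∘ suc) (ℕ.suc-injective e))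
    consecutive-tabulate⁺ f {zero}  {suc (suc b)} ()

    consecutive-tabulate⁻ : ∀ {n} (f : Fin n → A) {x y} → Consecutive (tabulate f) x y →
                            ∃₂ λ a b → toℕ b ≡ suc (toℕ a) × f a ≡ x × f b ≡ y
    consecutive-tabulate⁻ {suc (suc n)} f first     = zero , suc zero , refl , refl , refl
    consecutive-tabulate⁻ {suc (suc n)} f (later c) with a , b , e , fa , fb ← consecutive-tabulate⁻ (f ∘ suc) c =
      suc a , suc b , cong suc e , fa , fb
    consecutive-tabulate⁻ {suc zero}    f (later ())

    tabulate-last : ∀ {n} (f : Fin (suc n) → A) → tabulate f ≡ tabulate (f ∘ Fin.inject₁) ∷ʳ f (Fin.fromℕ n)
    tabulate-last {zero}  f = refl
    tabulate-last {suc n} f = cong (f zero ∷_) (tabulate-last (f ∘ suc))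

    cyclic-tabulate⁺ : ∀ {n} (f : Fin n → A) {a b} → Next n (toℕ a) (toℕ b) → Cyclic (tabulate f) (f a) (f b)
    cyclic-tabulate⁺ {suc n} f (inj₁ e) = consecutive-++⁺ˡ [ f zero ] (consecutive-tabulate⁺ f e)
    cyclic-tabulate⁺ {suc n} f {a} {b} (inj₂ (1+a≡1+n , b≡0))
      rewrite Fin.toℕ-injective {i = a} (trans (ℕ.suc-injective 1+a≡1+n) (sym (Fin.toℕ-fromℕ n)))
            | Fin.toℕ-injective {i = b} {j = zero} b≡0 =
      ≡-consecutive (cong (_∷ʳ f zero) (sym (tabulate-last f)))
                    (consecutive-∷ʳ∷ʳ⁺ (tabulate (f ∘ Fin.inject₁)) (f (Fin.fromℕ n)) (f zero) (inj₂ (refl , refl)))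

    cyclic-tabulate⁻ : ∀ {n} (f : Fin n → A) {x y} → Cyclic (tabulate f) x y →
                       ∃₂ λ a b → Next n (toℕ a) (toℕ b) × f a ≡ x × f b ≡ y
    cyclic-tabulate⁻ {suc n} f c with consecutive-∷ʳ⁻ (tabulate f) (f zero) c
    ... | inj₁ c′ with a , b , e , fa , fb ← consecutive-tabulate⁻ f c′ = a , b , inj₁ e , fa , fb
    ... | inj₂ (L , eq , refl) =
      Fin.fromℕ n , zero , inj₂ (cong suc (Fin.toℕ-fromℕ n) , refl) ,
      List.∷ʳ-injectiveʳ (tabulate (f ∘ Fin.inject₁)) L (trans (sym (tabulate-last f)) eq) , refl

  cycleEdge-tabulate⁺ : ∀ {n} (f : Fin n → A) {a b} → Adjacent (cycleAdj n) a b → CycleEdge (tabulate f) (f a) (f b)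
  cycleEdge-tabulate⁺ f {a} {b} ab = Sum.map (cyclic-tabulate⁺ f) (cyclic-tabulate⁺ f) (cycleAdj⇒CycleStep a b ab)

  cyclic-tabulate⇒cycleAdj : ∀ {n} (f : Fin n → A) {x y} → Cyclic (tabulate f) x y →
                             ∃₂ λ a b → Adjacent (cycleAdj n) a b × f a ≡ x × f b ≡ y
  cyclic-tabulate⇒cycleAdj f c with a , b , ab , fa , fb ← cyclic-tabulate⁻ f c = a , b , CycleStep⇒cycleAdj a b (inj₁ ab) , fa , fb

tabulate-lookup-cast : ∀ {A : Set} {n} (K : List A) (len : length K ≡ n) → tabulate (lookup K ∘ Fin.cast (sym len)) ≡ K
tabulate-lookup-cast K refl = trans (List.tabulate-cong (λ i → cong (lookup K) (Fin.cast-is-id refl i))) (List.tabulate-lookup K)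

enumeration⇒bijection : ∀ {n} (K : List (Fin n)) → Unique K → (∀ x → x ∈ K) → length K ≡ n →
                        Σ (Fin n ↔ Fin n) λ σ → K ≡ tabulate (Inverse.to σ)
enumeration⇒bijection K unique complete len = mk↔ₛ′ to from to∘from from∘to , sym (tabulate-lookup-cast K len)
  where
  to from : _ → _
  to i   = lookup K (Fin.cast (sym len) i)
  from x = Fin.cast len (Any.index (complete x))
  to∘from : ∀ x → to (from x) ≡ x
  to∘from x = trans (cong (lookup K) (Fin.cast-involutive (sym len) len _)) (sym (lookup-index (complete x)))
  from∘to : ∀ i → from (to i) ≡ i
  from∘to i = trans (cong (Fin.cast len) (lookup-injective unique _ _ (sym (lookup-index (complete (to i))))))
                    (Fin.cast-involutive len (sym len) i)

imageAdj-cycleEdge⁺ : ∀ {n} (π : Fin n ↔ Fin n) {x y} →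
                      Adjacent (imageAdj π (cycleAdj n)) x y → CycleEdge (tabulate (Inverse.to π)) x y
imageAdj-cycleEdge⁺ π {x} {y} xy = subst₂ (CycleEdge (tabulate to)) (strictlyInverseˡ x) (strictlyInverseˡ y) (cycleEdge-tabulate⁺ to xy)
  where open Inverse π

imageAdj-cycleEdge⁻ : ∀ {n} (π : Fin n ↔ Fin n) {x y} →
                      CycleEdge (tabulate (Inverse.to π)) x y → Adjacent (imageAdj π (cycleAdj n)) x y
imageAdj-cycleEdge⁻ {n} π {x} {y} = Sum.[ step , trans (cycleAdj-symmetric (from x) (from y)) ∘ step ]′
  where
  open Inverse π
  step : ∀ {x y} → Cyclic (tabulate to) x y → Adjacent (imageAdj π (cycleAdj n)) x y
  step c with a , b , ab , refl , refl ← cyclic-tabulate⇒cycleAdj to c =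
    subst₂ (Adjacent (cycleAdj n)) (sym (strictlyInverseʳ a)) (sym (strictlyInverseʳ b)) ab

arrangement⇒hamiltonian : ∀ {n} {G : Adj n} → (∀ i j → G i j ≡ G j i) →
                          (K : List (Fin n)) → Unique K → (∀ x → x ∈ K) → length K ≡ n →
                          (∀ {x y} → Cyclic K x y → Adjacent G x y) → HasHamiltonianCycle G
arrangement⇒hamiltonian {n} {G} G-sym K unique complete len good
  with σ , K≡tabulate ← enumeration⇒bijection K unique complete len = σ , λ a b ab →
    Sum.[ good , trans (G-sym _ _) ∘ good ]′
      (subst (λ L → CycleEdge L (Inverse.to σ a) (Inverse.to σ b)) (sym K≡tabulate) (cycleEdge-tabulate⁺ (Inverse.to σ) {a} {b} ab))

cycle-subgraph : ∀ {n} {G : Adj n} (σ : Fin n ↔ Fin n) →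
                 (∀ a b → Adjacent (cycleAdj n) a b → Adjacent G (Inverse.to σ a) (Inverse.to σ b)) →
                 ∀ i j → Adjacent (imageAdj σ (cycleAdj n)) i j → Adjacent G i j
cycle-subgraph {G = G} σ hamiltonian i j ij =
  subst₂ (Adjacent G) (Inverse.strictlyInverseˡ σ i) (Inverse.strictlyInverseˡ σ j) (hamiltonian _ _ ij)

module _ {n} {G : Adj n} (G-simple : IsSimple G) (G-cubic : ∀ i → degree G i ≤ 3) where
  open Squares G

  private
    max-degree-3 : ∀ {x ps} → Unique ps → All (Adjacent G x) ps → length ps ≤ 3
    max-degree-3 {x} unique adjacent = ℕ.≤-trans (degree-≥ G unique adjacent) (G-cubic x)

  hamiltonian-from-embedding : 3 ≤ n → (π : Fin n ↔ Fin n) →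
    (∀ x → quadForm (imageAdj π (cycleAdj n)) x ℚ.≤ quadForm G x) → HasHamiltonianCycle G
  hamiltonian-from-embedding 3≤n π H≼G =
    finish (HamiltonianSearch.hamiltonian-arrangement G (IsSimple.symmetric G-simple) (IsSimple.irreflexive G-simple) max-degree-3
                                                      K₀ K₀-unique K₀-invariant)
    where
    K₀ : List (Fin n)
    K₀ = tabulate (Inverse.to π)

    K₀-unique : Unique K₀
    K₀-unique = Unique.tabulate⁺ (Injection.injective (↔⇒↣ π))

    K₀-invariant : Invariant (CycleEdge K₀)
    K₀-invariant = Invariant-resp (imageAdj-cycleEdge⁺ π) (imageAdj-cycleEdge⁻ π)
      (LaplacianDominance.invariant G-simple G-cubic (imageAdj-isCycleLike π (cycleAdj-isCycleLike 3≤n)) H≼G)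

    finish : (∃ λ K* → K* ↭ K₀ × (∀ {x y} → Cyclic K* x y → Adjacent G x y)) → HasHamiltonianCycle G
    finish (K* , K*↭K₀ , good) = arrangement⇒hamiltonian (IsSimple.symmetric G-simple) K*
      (Unique-resp-↭ (↭-sym K*↭K₀) K₀-unique)
      (λ x → Perm.∈-resp-↭ (↭-sym K*↭K₀) (subst (_∈ K₀) (Inverse.strictlyInverseˡ π x) (∈-tabulate⁺ (Inverse.from π x))))
      (trans (Perm.↭-length K*↭K₀) (List.length-tabulate (Inverse.to π)))
      good

theorem3 : (n : ℕ) → n ℕ.≥ 3 → (G : CubicSubgrid n) →
    (Σ (Fin n ↔ Fin n) λ π → (x : Fin n → ℚ) →
       quadForm (imageAdj π (cycleAdj n)) x ℚ.≤ quadForm (CubicSubgrid.adj G) x)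
    ⇔ HasHamiltonianCycle (CubicSubgrid.adj G)
theorem3 n 3≤n G = mk⇔
  (λ (π , H≼G) → hamiltonian-from-embedding simple deg≤3 3≤n π H≼G)
  (λ (σ , hamiltonian) → σ , quadForm-mono (cycle-subgraph σ hamiltonian))
  where
  open CubicSubgrid G
  simple : IsSimple adj
  simple = record { symmetric = adj-sym ; irreflexive = adj-irr }
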